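{- For the universal bipartite graph $\mathcal{B}(n)$, one has $\mathrm{tww}(\mathcal{B}(n)) = n - \log_2(n) + \mathcal{O}(1)$ as $n\to\infty$.
   Context: For a positive integer $n$, $[n]=\{1,\dots,n\}$ and $2^{[n]}$ is its power set. The universal bipartite graph is $\mathcal{B}(n)=([n],\,2^{[n]},\,E)$, the bipartite graph with vertex set the disjoint union of $[n]$ and $2^{[n]}$, where $k\in[n]$ is adjacent to $S\in 2^{[n]}$ iff $k\in S$. Twin-width: a trigraph is a triple $(V,E,R)$ with $E,R$ disjoint edge sets (ordinary and red edges); a graph is a trigraph with no red edges. Contracting two vertices $u,v$ (not necessarily adjacent) into a new vertex $w$ gives the trigraph in which $w$ replaces $u,v$, everything not involving $u,v$ is unchanged, $w$'s ordinary neighbourhood is $N(u)\cap N(v)$ and its red neighbourhood is $R(u)\cup R(v)\cup (N(u)\,\Delta\,N(v))$. A $d$-contraction sequence is a sequence of contractions down to a single vertex where every intermediate trigraph has maximum red degree at most $d$; $\mathrm{tww}$ is the least such $d$. -}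

module Defs where

open import Data.Nat using (ℕ; zero; suc; _+_; _^_; _≤_; _/_; _%_; _≡ᵇ_)
open import Data.Bool using (Bool; true; false; if_then_else_)
open import Data.Fin using (Fin; toℕ; punchIn; splitAt; _≟_)
open import Data.Sum using (_⊎_; inj₁; inj₂)
open import Data.List using (length; filter)
open import Data.List using (List)
open import Data.Fin.Base using ()
open import Data.List.Base using ()
open import Relation.Nullary using (yes; no; ¬_)
open import Relation.Binary.PropositionalEquality using (_≡_; _≢_)

data Colour : Set where
  none black red : Colour

-- A trigraph on the vertex set Fin m: the colour of every pair (x , y).
-- (Graphs are trigraphs with no red colour; loops are never present.)
Trigraph : ℕ → Set
Trigraph m = Fin m → Fin m → Colour

isRed : (c : Colour) → Relation.Nullary.Dec (c ≡ red)
isRed none = no (λ ())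
isRed black = no (λ ())
isRed red = yes Relation.Binary.PropositionalEquality.refl

allFin : (m : ℕ) → List (Fin m)
allFin m = Data.List.tabulate (λ i → i)

redDeg : ∀ {m} → Trigraph m → Fin m → ℕ
redDeg {m} T x = length (filter (λ y → isRed (T x y)) (allFin m))

RedBounded : ∀ {m} → ℕ → Trigraph m → Set
RedBounded d T = ∀ x → redDeg T x ≤ d

-- colour of the merged vertex w towards a vertex z, given the colours
-- of u and v towards z: black iff z ∈ N(u) ∩ N(v); red iff
-- z ∈ R(u) ∪ R(v) ∪ (N(u) Δ N(v)); none otherwise.
merge : Colour → Colour → Colour
merge black black = black
merge none none = none
merge _ _ = red

-- Contraction of u and v in a trigraph on Fin (suc m).  The result lives on
-- Fin m ≅ Fin (suc m) ∖ {v} via punchIn v; the new vertex w occupies the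
-- old place of u.
contract : ∀ {m} → Trigraph (suc m) → Fin (suc m) → Fin (suc m) → Trigraph m
contract T u v x y with punchIn v x ≟ u | punchIn v y ≟ u
... | yes _ | yes _ = none
... | yes _ | no _  = merge (T u (punchIn v y)) (T v (punchIn v y))
... | no _  | yes _ = merge (T (punchIn v x) u) (T (punchIn v x) v)
... | no _  | no _  = T (punchIn v x) (punchIn v y)

data ContractionSeq (d : ℕ) : ∀ {m} → Trigraph m → Set where
  single : (T : Trigraph 1) → RedBounded d T → ContractionSeq d T
  step   : ∀ {m} (T : Trigraph (suc (suc m))) → RedBounded d T →
           (u v : Fin (suc (suc m))) → u ≢ v →
           ContractionSeq d (contract T u v) → ContractionSeq d T

testBit : ℕ → ℕ → Bool
testBit s zero = (s % 2) ≡ᵇ 1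
testBit s (suc k) = testBit (s / 2) k

-- The universal bipartite graph B(n) on Fin (n + 2^n): the first n vertices are
-- the elements k ∈ [n] (k = toℕ i + 1), the remaining 2^n vertices are the
-- subsets S ⊆ [n], subset number s being {k : bit (k-1) of s is 1}.
-- k ~ S iff k ∈ S.
memberColour : ℕ → ℕ → Colour
memberColour k s = if testBit s k then black else none

universalBipartite : (n : ℕ) → Trigraph (n + 2 ^ n)
universalBipartite n x y with splitAt n x | splitAt n y
... | inj₁ k | inj₂ s = memberColour (toℕ k) (toℕ s)
... | inj₂ s | inj₁ k = memberColour (toℕ k) (toℕ s)
... | inj₁ _ | inj₁ _ = none
... | inj₂ _ | inj₂ _ = none

-- Contracting the parts of a partition of a graph, in any order, yields its quotient trigraph: two
-- parts are joined black (none) if all pairs between them are, and red otherwise.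
--
-- Let t = ⌊log₂ n⌋ − 2. First merge the subsets, one at a time, into 2^t classes by
-- their traces on the first t elements, then merge the elements t, …, n − 1 into one vertex. An
-- element part only has red edges to the 2^t subset classes, and a subset part only to the n − t
-- large elements, so red degree n − t suffices and leaves t + 1 + 2^t ≤ n − t parts.
--
-- Consider the first contraction touching an element k. It merges k with a vertex c
-- that misses every subset avoiding some element l ≠ k. Each of the 2^(n−2) subsets containing k
-- but not l is then either in the merged part or in one of its at most d red neighbours, and within
-- a part a subset is determined by its pattern on the at most d red elements of that part. Hence
-- 2^(n−2) ≤ (d + 1) 2^(d+1), that is n ≤ d + log₂ n + 3.

module Submission where

open import Data.Bool using (Bool; true; false; _∧_; _∨_; if_then_else_)
import Data.Bool.Properties as Bool
open import Data.Empty using (⊥; ⊥-elim)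
open import Data.Fin using (Fin; toℕ; fromℕ<; splitAt; _↑ˡ_; _↑ʳ_; punchIn; punchOut; _≟_)
import Data.Fin as Fin
open import Data.Fin.Properties
  using (any?; toℕ-fromℕ<; toℕ-injective; toℕ<n; splitAt-↑ˡ; splitAt-↑ʳ; splitAt⁻¹-↑ˡ; splitAt⁻¹-↑ʳ;
         ↑ˡ-injective; punchIn-injective; punchInᵢ≢i; punchIn-punchOut; punchOut-punchIn; punchOut-cong)
open import Data.List using (List; []; _∷_; [_]; _++_; length; map; filter; applyUpTo; cartesianProduct)
open import Data.List.Properties
  using (length-++; length-map; length-tabulate; length-applyUpTo; ∷-injectiveˡ; ∷-injectiveʳ)
open import Data.List.Membership.Propositional using (_∈_)
open import Data.List.Membership.Propositional.Properties
  using (∈-applyUpTo⁺; ∈-cartesianProduct⁺; ∈-∃++; ∈-++⁻; ∈-++⁺ˡ; ∈-++⁺ʳ; ∈-filter⁺; ∈-filter⁻;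
         ∈-allFin; ∈-map⁺; ∈-map⁻)
open import Data.List.Relation.Binary.Subset.Propositional using (_⊆_)
open import Data.List.Relation.Unary.Any using (here; there)
import Data.List.Relation.Unary.All as All
import Data.List.Relation.Unary.All.Properties as All
open import Data.List.Relation.Unary.Unique.Propositional using (Unique; []; _∷_)
import Data.List.Relation.Unary.Unique.Propositional.Properties as Unique
open import Data.Maybe using (Maybe; just; nothing; when; fromMaybe)
open import Data.Nat
  using (ℕ; zero; suc; _+_; _*_; _^_; _∸_; _/_; _%_; ⌊_/2⌋; ⌈_/2⌉; _≡ᵇ_; _≤_; _<_; _≤?_; _<?_;
         s≤s; z≤n; NonZero; >-nonZero)
open import Data.Nat.Properties
  using (≤-refl; ≤-trans; ≤-reflexive; ≤-antisym; ≤-pred; <⇒≤; <⇒≱; ≰⇒>; ≮⇒≥; ≤∧≢⇒<; <-irrefl;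
         <-≤-trans; n≤1+n; n<1+n; m≤n⇒m≤1+n; m≤m+n; m≤n+m; m<m+n; m+n≮m; +-mono-≤; +-monoˡ-≤;
         +-monoʳ-≤; *-mono-≤; *-monoˡ-≤; *-monoʳ-≤; +-suc; +-assoc; +-identityʳ; +-cancelˡ-≡; *-suc;
         *-comm; *-assoc; m∸n+n≡m; m+[n∸m]≡n; m+n≤o⇒m≤o∸n; ∸-monoˡ-<; suc-pred; ⌊n/2⌋<n;
         ⌊n/2⌋≤⌈n/2⌉; ⌊n/2⌋+⌈n/2⌉≡n; ^-distribˡ-+-*; ^-monoʳ-≤; m^n>0; m^n≢0; m*n≢0; module ≤-Reasoning)
open import Data.Nat.DivMod
  using ([m+kn]%n≡m%n; m*n/n≡m; +-distrib-/-∣ʳ; m%n<n; m<n⇒m%n≡m; m∣n⇒o%n%m≡o%m; m%[n*o]/o≡m/o%n;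
         %-congʳ; /-congˡ)
open import Data.Nat.Divisibility using (divides)
open import Data.Nat.Induction using (<-rec)
open import Data.Nat.Logarithm
  using (⌊log₂_⌋; ⌊log₂⌋-mono-≤; ⌊log₂⌊n/2⌋⌋≡⌊log₂n⌋∸1; ⌊log₂[2^n]⌋≡n; ⌊log₂[2*b]⌋≡1+⌊log₂b⌋)
open import Data.Nat.Tactic.RingSolver using (solve-∀)
open import Data.Product using (Σ; _×_; _,_; _,′_; proj₁; proj₂; ∃; ∃-syntax)
open import Data.Sum using (_⊎_; inj₁; inj₂; [_,_]′)
open import Data.Vec using (Vec; []; _∷_; lookup; _[_]≔_)
import Data.Vec.Properties as Vec
open import Data.Vec.Properties using (tabulate∘lookup; tabulate-cong; lookup∘update; lookup∘update′)
open import Function using (_∘_; case_of_; _⇔_; mk⇔)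
open import Relation.Nullary using (¬_; Dec; yes; no; does)
open import Relation.Nullary.Decidable using (dec-true; does-⇔; _⊎-dec_; _×-dec_)
open import Relation.Binary.PropositionalEquality hiding ([_])

open import Defs

private
  variable
    A B : Set

-- Counting with duplicate-free lists

Unique∧⊆⇒length≤ : {xs ys : List A} → Unique xs → xs ⊆ ys → length xs ≤ length ys
Unique∧⊆⇒length≤ {xs = []} _ _ = z≤n
Unique∧⊆⇒length≤ {xs = x ∷ xs} (x∉xs ∷ u) xs⊆ys with ∈-∃++ (xs⊆ys (here refl))
... | us , vs , refl = begin
  suc (length xs)          ≤⟨ s≤s (Unique∧⊆⇒length≤ u xs⊆us++vs) ⟩
  suc (length (us ++ vs))  ≡⟨ cong suc (length-++ us) ⟩
  suc (length us + length vs) ≡⟨ +-suc (length us) (length vs) ⟨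
  length us + length (x ∷ vs) ≡⟨ length-++ us ⟨
  length (us ++ x ∷ vs)    ∎
  where
  open ≤-Reasoning
  xs⊆us++vs : xs ⊆ us ++ vs
  xs⊆us++vs z∈xs with ∈-++⁻ us (xs⊆ys (there z∈xs))
  ... | inj₁ z∈us         = ∈-++⁺ˡ z∈us
  ... | inj₂ (here refl)  = ⊥-elim (All.lookup x∉xs z∈xs refl)
  ... | inj₂ (there z∈vs) = ∈-++⁺ʳ us z∈vs

InjectiveOn : (A → B) → List A → Set
InjectiveOn f xs = ∀ {a b} → a ∈ xs → b ∈ xs → f a ≡ f b → a ≡ b

Unique-map⁺ : ∀ (f : A → B) {xs} → InjectiveOn f xs → Unique xs → Unique (map f xs)
Unique-map⁺ f inj [] = []
Unique-map⁺ f inj (x∉xs ∷ u) =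
  All.map⁺ (All.tabulate λ y∈xs fx≡fy → All.lookup x∉xs y∈xs (inj (here refl) (there y∈xs) fx≡fy))
  ∷ Unique-map⁺ f (λ a∈xs b∈xs → inj (there a∈xs) (there b∈xs)) u

injectiveOn⇒length≤ : ∀ (f : A → B) {xs ys} → Unique xs → InjectiveOn f xs →
                      (∀ {a} → a ∈ xs → f a ∈ ys) → length xs ≤ length ys
injectiveOn⇒length≤ f {xs} u inj f∈ys = ≤-trans (≤-reflexive (sym (length-map f xs)))
  (Unique∧⊆⇒length≤ (Unique-map⁺ f inj u) λ z∈ → case ∈-map⁻ f z∈ of λ where (_ , a∈ , refl) → f∈ys a∈)

map-≡⇒≡ : ∀ {xs : List A} {g h : A → B} → map g xs ≡ map h xs → ∀ {x} → x ∈ xs → g x ≡ h x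
map-≡⇒≡ {xs = _ ∷ _} eq (here refl)  = ∷-injectiveˡ eq
map-≡⇒≡ {xs = _ ∷ _} eq (there x∈xs) = map-≡⇒≡ (∷-injectiveʳ eq) x∈xs

length-cartesianProduct : (xs : List A) (ys : List B) →
                          length (cartesianProduct xs ys) ≡ length xs * length ys
length-cartesianProduct []       ys = refl
length-cartesianProduct (x ∷ xs) ys = trans (length-++ (map (x ,_) ys))
  (cong₂ _+_ (length-map (x ,_) ys) (length-cartesianProduct xs ys))

module _ {m : ℕ} (T : Trigraph m) (x : Fin m) where

  redDeg≤length : {L : List (Fin m)} → (∀ y → T x y ≡ red → y ∈ L) → redDeg T x ≤ length L
  redDeg≤length red⇒∈L = Unique∧⊆⇒length≤ (Unique.filter⁺ (λ y → isRed (T x y)) (Unique.allFin⁺ m))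
    λ y∈ → red⇒∈L _ (proj₂ (∈-filter⁻ (λ y → isRed (T x y)) {xs = allFin m} y∈))

  length≤redDeg : {L : List (Fin m)} → Unique L → (∀ {y} → y ∈ L → T x y ≡ red) → length L ≤ redDeg T x
  length≤redDeg u ∈L⇒red = Unique∧⊆⇒length≤ u λ y∈ → ∈-filter⁺ (λ y → isRed (T x y)) (∈-allFin _) (∈L⇒red y∈)

  redDeg≤order : redDeg T x ≤ m
  redDeg≤order = ≤-trans (redDeg≤length (λ y _ → ∈-allFin y)) (≤-reflexive (length-tabulate (λ i → i)))

redDeg-cong : ∀ {m} {T T′ : Trigraph m} x → (∀ y → T x y ≡ T′ x y) → redDeg T x ≡ redDeg T′ x
redDeg-cong {m} {T} {T′} x T≗T′ = ≤-antisym (bound T T′ T≗T′) (bound T′ T (λ y → sym (T≗T′ y)))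
  where
  bound : (U V : Trigraph m) → (∀ y → U x y ≡ V x y) → redDeg U x ≤ redDeg V x
  bound U V U≗V = redDeg≤length U x λ y r →
    ∈-filter⁺ (λ y → isRed (V x y)) (∈-allFin y) (trans (sym (U≗V y)) r)

merge-comm : ∀ a b → merge a b ≡ merge b a
merge-comm none  none  = refl
merge-comm none  black = refl
merge-comm none  red   = refl
merge-comm black none  = refl
merge-comm black black = refl
merge-comm black red   = refl
merge-comm red   none  = refl
merge-comm red   black = refl
merge-comm red   red   = refl

merge-assoc : ∀ a b c → merge (merge a b) c ≡ merge a (merge b c)
merge-assoc none  none  none  = refl
merge-assoc none  none  black = refl
merge-assoc none  none  red   = refl
merge-assoc none  black none  = refl
merge-assoc none  black black = refl
merge-assoc none  black red   = refl
merge-assoc black none  none  = refl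
merge-assoc black none  black = refl
merge-assoc black none  red   = refl
merge-assoc black black none  = refl
merge-assoc black black black = refl
merge-assoc black black red   = refl
merge-assoc none  red   _     = refl
merge-assoc black red   _     = refl
merge-assoc red   _     _     = refl

merge-idem : ∀ a → merge a a ≡ a
merge-idem none  = refl
merge-idem black = refl
merge-idem red   = refl

-- nothing is the join of the empty family of colours
infixr 6 _⊔_
_⊔_ : Maybe Colour → Maybe Colour → Maybe Colour
nothing ⊔ y       = y
just a  ⊔ nothing = just a
just a  ⊔ just b  = just (merge a b)

⊔-identityʳ : ∀ x → x ⊔ nothing ≡ x
⊔-identityʳ nothing  = refl
⊔-identityʳ (just _) = refl

⊔-comm : ∀ x y → x ⊔ y ≡ y ⊔ x
⊔-comm nothing  y        = sym (⊔-identityʳ y)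
⊔-comm (just a) nothing  = refl
⊔-comm (just a) (just b) = cong just (merge-comm a b)

⊔-assoc : ∀ x y z → (x ⊔ y) ⊔ z ≡ x ⊔ (y ⊔ z)
⊔-assoc nothing  y        z        = refl
⊔-assoc (just a) nothing  z        = refl
⊔-assoc (just a) (just b) nothing  = refl
⊔-assoc (just a) (just b) (just c) = cong just (merge-assoc a b c)

⊔-idem : ∀ x → x ⊔ x ≡ x
⊔-idem nothing  = refl
⊔-idem (just a) = cong just (merge-idem a)

⊔-interchange : ∀ w x y z → (w ⊔ x) ⊔ (y ⊔ z) ≡ (w ⊔ y) ⊔ (x ⊔ z)
⊔-interchange w x y z = begin
  (w ⊔ x) ⊔ (y ⊔ z) ≡⟨ ⊔-assoc w x (y ⊔ z) ⟩
  w ⊔ (x ⊔ (y ⊔ z)) ≡⟨ cong (w ⊔_) (⊔-assoc x y z) ⟨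
  w ⊔ ((x ⊔ y) ⊔ z) ≡⟨ cong (λ q → w ⊔ (q ⊔ z)) (⊔-comm x y) ⟩
  w ⊔ ((y ⊔ x) ⊔ z) ≡⟨ cong (w ⊔_) (⊔-assoc y x z) ⟩
  w ⊔ (y ⊔ (x ⊔ z)) ≡⟨ ⊔-assoc w y (x ⊔ z) ⟨
  (w ⊔ y) ⊔ (x ⊔ z) ∎
  where open ≡-Reasoning

infix 4 _≼_
_≼_ : Maybe Colour → Maybe Colour → Set
x ≼ y = x ⊔ y ≡ y

≼-trans : ∀ {x y z} → x ≼ y → y ≼ z → x ≼ z
≼-trans {x} {y} {z} x≼y y≼z = begin
  x ⊔ z       ≡⟨ cong (x ⊔_) y≼z ⟨
  x ⊔ (y ⊔ z) ≡⟨ ⊔-assoc x y z ⟨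
  (x ⊔ y) ⊔ z ≡⟨ cong (_⊔ z) x≼y ⟩
  y ⊔ z       ≡⟨ y≼z ⟩
  z           ∎
  where open ≡-Reasoning

≼-antisym : ∀ {x y} → x ≼ y → y ≼ x → x ≡ y
≼-antisym {x} {y} x≼y y≼x = trans (sym y≼x) (trans (⊔-comm y x) x≼y)

just≼⇒≢nothing : ∀ {c y} → just c ≼ y → y ≢ nothing
just≼⇒≢nothing {y = just _} _ ()

≼just⇒≢red : ∀ {x c} → c ≢ red → x ≼ just c → fromMaybe none x ≢ red
≼just⇒≢red {nothing}    _     _     ()
≼just⇒≢red {just none}  _     _     ()
≼just⇒≢red {just black} _     _     ()
≼just⇒≢red {just red}   c≢red red≼c _ = c≢red (sym (cong (fromMaybe none) red≼c))

black≼∧none≼⇒≡red : ∀ {y} → just black ≼ y → just none ≼ y → y ≡ just red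
black≼∧none≼⇒≡red {just red} _ _ = refl

fromMaybe-⊔ : ∀ {x y} → x ≢ nothing → y ≢ nothing →
              fromMaybe none (x ⊔ y) ≡ merge (fromMaybe none x) (fromMaybe none y)
fromMaybe-⊔ {nothing} x≢n _ = ⊥-elim (x≢n refl)
fromMaybe-⊔ {just _} {nothing} _ y≢n = ⊥-elim (y≢n refl)
fromMaybe-⊔ {just _} {just _} _ _ = refl

⨆ : List A → (A → Maybe Colour) → Maybe Colour
⨆ []       h = nothing
⨆ (a ∷ as) h = h a ⊔ ⨆ as h

⨆-cong : ∀ (as : List A) {h h′} → (∀ a → h a ≡ h′ a) → ⨆ as h ≡ ⨆ as h′
⨆-cong []       h≗h′ = refl
⨆-cong (a ∷ as) h≗h′ = cong₂ _⊔_ (h≗h′ a) (⨆-cong as h≗h′)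

⨆-distrib-⊔ : ∀ (as : List A) {h h₁ h₂} → (∀ a → h a ≡ h₁ a ⊔ h₂ a) → ⨆ as h ≡ ⨆ as h₁ ⊔ ⨆ as h₂
⨆-distrib-⊔ []       _ = refl
⨆-distrib-⊔ (a ∷ as) {h} {h₁} {h₂} h≗ =
  trans (cong₂ _⊔_ (h≗ a) (⨆-distrib-⊔ as h≗)) (⊔-interchange (h₁ a) (h₂ a) (⨆ as h₁) (⨆ as h₂))

≼-⨆ : ∀ {as : List A} (h : A → Maybe Colour) {a} → a ∈ as → h a ≼ ⨆ as h
≼-⨆ {as = b ∷ as} h (here refl) = trans (sym (⊔-assoc (h b) (h b) (⨆ as h))) (cong (_⊔ ⨆ as h) (⊔-idem (h b)))
≼-⨆ {as = b ∷ as} h {a} (there a∈as) = begin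
  h a ⊔ (h b ⊔ ⨆ as h) ≡⟨ ⊔-assoc (h a) (h b) _ ⟨
  (h a ⊔ h b) ⊔ ⨆ as h ≡⟨ cong (_⊔ ⨆ as h) (⊔-comm (h a) (h b)) ⟩
  (h b ⊔ h a) ⊔ ⨆ as h ≡⟨ ⊔-assoc (h b) (h a) _ ⟩
  h b ⊔ (h a ⊔ ⨆ as h) ≡⟨ cong (h b ⊔_) (≼-⨆ h a∈as) ⟩
  h b ⊔ ⨆ as h         ∎
  where open ≡-Reasoning

⨆-least : ∀ (as : List A) {h z} → (∀ a → h a ≼ z) → ⨆ as h ≼ z
⨆-least []       _   = refl
⨆-least (a ∷ as) {h} {z} h≼z =
  trans (⊔-assoc (h a) (⨆ as h) z) (trans (cong (h a ⊔_) (⨆-least as h≼z)) (h≼z a))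

when-∨ˡ : ∀ p q r c → when ((p ∨ q) ∧ r) c ≡ when (p ∧ r) c ⊔ when (q ∧ r) c
when-∨ˡ false false r     c = refl
when-∨ˡ false true  r     c = refl
when-∨ˡ true  false false c = refl
when-∨ˡ true  false true  c = refl
when-∨ˡ true  true  false c = refl
when-∨ˡ true  true  true  c = cong just (sym (merge-idem c))

when-∨ʳ : ∀ p q r c → when (r ∧ (p ∨ q)) c ≡ when (r ∧ p) c ⊔ when (r ∧ q) c
when-∨ʳ p     q     false c = refl
when-∨ʳ false false true  c = refl
when-∨ʳ false true  true  c = refl
when-∨ʳ true  false true  c = refl
when-∨ʳ true  true  true  c = cong just (sym (merge-idem c))

module Collapse {m : ℕ} {u v : Fin (suc (suc m))} (u≢v : u ≢ v) where

  -- the vertex map underlying contract T u v: v goes to the place of u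
  collapse : Fin (suc (suc m)) → Fin (suc m)
  collapse z with v ≟ z
  ... | yes _   = punchOut (u≢v ∘ sym)
  ... | no v≢z  = punchOut v≢z

  punchIn-collapse : ∀ z → (z ≢ v × punchIn v (collapse z) ≡ z) ⊎ (z ≡ v × punchIn v (collapse z) ≡ u)
  punchIn-collapse z with v ≟ z
  ... | yes refl = inj₂ (refl , punchIn-punchOut _)
  ... | no v≢z   = inj₁ (v≢z ∘ sym , punchIn-punchOut v≢z)

  collapse-punchIn : ∀ x → collapse (punchIn v x) ≡ x
  collapse-punchIn x with v ≟ punchIn v x
  ... | yes v≡ = ⊥-elim (punchInᵢ≢i v x (sym v≡))
  ... | no _   = trans (punchOut-cong v refl) (punchOut-punchIn v)

  collapse-u≡v : collapse u ≡ collapse v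
  collapse-u≡v with punchIn-collapse u | punchIn-collapse v
  ... | inj₁ (_ , pu) | inj₂ (_ , pv) = punchIn-injective v _ _ (trans pu (sym pv))
  ... | inj₂ (u≡v , _) | _            = ⊥-elim (u≢v u≡v)
  ... | _ | inj₁ (v≢v , _)            = ⊥-elim (v≢v refl)

  collapse-≡⁻ : ∀ {z z′} → collapse z ≡ collapse z′ → z ≡ z′ ⊎ (z ≡ u × z′ ≡ v) ⊎ (z ≡ v × z′ ≡ u)
  collapse-≡⁻ {z} {z′} eq with punchIn-collapse z | punchIn-collapse z′
  ... | inj₁ (_ , p)  | inj₁ (_ , q)  = inj₁ (trans (sym p) (trans (cong (punchIn v) eq) q))
  ... | inj₁ (_ , p)  | inj₂ (z′≡v , q) = inj₂ (inj₁ (trans (sym p) (trans (cong (punchIn v) eq) q) , z′≡v))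
  ... | inj₂ (z≡v , p) | inj₁ (_ , q) = inj₂ (inj₂ (z≡v , trans (sym q) (trans (cong (punchIn v) (sym eq)) p)))
  ... | inj₂ (z≡v , _) | inj₂ (z′≡v , _) = inj₁ (trans z≡v (sym z′≡v))

  collapse-≡-punchIn : ∀ {x} → punchIn v x ≢ u → ∀ z → collapse z ≡ x ⇔ z ≡ punchIn v x
  collapse-≡-punchIn {x} x̂≢u z = mk⇔ to λ where refl → collapse-punchIn x
    where
    to : collapse z ≡ x → z ≡ punchIn v x
    to refl with punchIn-collapse z
    ... | inj₁ (_ , p) = sym p
    ... | inj₂ (_ , p) = ⊥-elim (x̂≢u p)

  collapse-≡-u : ∀ {x} → punchIn v x ≡ u → ∀ z → collapse z ≡ x ⇔ (z ≡ u ⊎ z ≡ v)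
  collapse-≡-u {x} x̂≡u z = mk⇔ to from
    where
    to : collapse z ≡ x → z ≡ u ⊎ z ≡ v
    to refl with punchIn-collapse z
    ... | inj₁ (_ , p)   = inj₁ (trans (sym p) x̂≡u)
    ... | inj₂ (z≡v , _) = inj₂ z≡v
    from : z ≡ u ⊎ z ≡ v → collapse z ≡ x
    from (inj₁ refl) = trans (cong collapse (sym x̂≡u)) (collapse-punchIn x)
    from (inj₂ refl) = trans (sym collapse-u≡v) (trans (cong collapse (sym x̂≡u)) (collapse-punchIn x))

-- Quotient trigraphs

Fin1-≡ : (x y : Fin 1) → x ≡ y
Fin1-≡ Fin.zero Fin.zero = refl

infix 4 _≈ᵀ_
_≈ᵀ_ : ∀ {m} → Trigraph m → Trigraph m → Set
T ≈ᵀ T′ = ∀ x y → T x y ≡ T′ x y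

Onto : ∀ {k m} → (Fin k → Fin m) → Set
Onto f = ∀ z → ∃ λ a → f a ≡ z

contract-cong : ∀ {m} {T T′ : Trigraph (suc m)} u v → T ≈ᵀ T′ → contract T u v ≈ᵀ contract T′ u v
contract-cong {T = T} {T′} u v T≈T′ x y with punchIn v x ≟ u | punchIn v y ≟ u
... | yes _ | yes _ = refl
... | yes _ | no _  = cong₂ merge (T≈T′ _ _) (T≈T′ _ _)
... | no _  | yes _ = cong₂ merge (T≈T′ _ _) (T≈T′ _ _)
... | no _  | no _  = T≈T′ _ _

RedBounded-cong : ∀ {m d} {T T′ : Trigraph m} → T ≈ᵀ T′ → RedBounded d T → RedBounded d T′
RedBounded-cong {T = T} {T′} T≈T′ bounded x =
  ≤-trans (≤-reflexive (sym (redDeg-cong {T = T} {T′} x (T≈T′ x)))) (bounded x)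

ContractionSeq-cong : ∀ {m d} {T T′ : Trigraph m} → T ≈ᵀ T′ → ContractionSeq d T → ContractionSeq d T′
ContractionSeq-cong T≈T′ (single _ bounded) = single _ (RedBounded-cong T≈T′ bounded)
ContractionSeq-cong {T = T} {T′} T≈T′ (step _ bounded u v u≢v seq) =
  step T′ (RedBounded-cong T≈T′ bounded) u v u≢v (ContractionSeq-cong (contract-cong {T = T} {T′} u v T≈T′) seq)

ContractionSeq⇒RedBounded : ∀ {m d} {T : Trigraph m} → ContractionSeq d T → RedBounded d T
ContractionSeq⇒RedBounded (single _ bounded)       = bounded
ContractionSeq⇒RedBounded (step _ bounded _ _ _ _) = bounded

order≤⇒ContractionSeq : ∀ {m d} (T : Trigraph (suc m)) → suc m ≤ d → ContractionSeq d T
order≤⇒ContractionSeq {zero}  T 1≤d = single T λ x → ≤-trans (redDeg≤order T x) 1≤d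
order≤⇒ContractionSeq {suc m} T m≤d =
  step T (λ x → ≤-trans (redDeg≤order T x) m≤d) Fin.zero (Fin.suc Fin.zero) (λ ())
    (order≤⇒ContractionSeq _ (≤-trans (n≤1+n _) m≤d))

module Quotient {N : ℕ} (G : Trigraph N) where

  fibreColour : ∀ {m} → (Fin N → Fin m) → Fin m → Fin m → Fin N → Fin N → Maybe Colour
  fibreColour f x y a b = when (does (f a ≟ x) ∧ does (f b ≟ y)) (G a b)

  joinColour : ∀ {m} → (Fin N → Fin m) → Fin m → Fin m → Maybe Colour
  joinColour f x y = ⨆ (allFin N) λ a → ⨆ (allFin N) (fibreColour f x y a)

  -- G with every fibre of f contracted to a vertex, in any order (see contract-quotient)
  quotient : ∀ {m} → (Fin N → Fin m) → Trigraph m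
  quotient f x y with x ≟ y
  ... | yes _ = none
  ... | no _  = fromMaybe none (joinColour f x y)

  module _ {m : ℕ} (f : Fin N → Fin m) where

    quotient-diag : ∀ x → quotient f x x ≡ none
    quotient-diag x with x ≟ x
    ... | yes _  = refl
    ... | no x≢x = ⊥-elim (x≢x refl)

    quotient-≢ : ∀ {x y} → x ≢ y → quotient f x y ≡ fromMaybe none (joinColour f x y)
    quotient-≢ {x} {y} x≢y with x ≟ y
    ... | yes x≡y = ⊥-elim (x≢y x≡y)
    ... | no _    = refl

    G≼joinColour : ∀ {x y a b} → f a ≡ x → f b ≡ y → just (G a b) ≼ joinColour f x y
    G≼joinColour {x} {y} {a} {b} fa≡x fb≡y = subst (_≼ joinColour f x y) fibre≡
      (≼-trans (≼-⨆ (fibreColour f x y a) (∈-allFin b))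
               (≼-⨆ (λ a → ⨆ (allFin N) (fibreColour f x y a)) (∈-allFin a)))
      where
      fibre≡ : fibreColour f x y a b ≡ just (G a b)
      fibre≡ rewrite dec-true (f a ≟ x) fa≡x | dec-true (f b ≟ y) fb≡y = refl

    Uniform : Fin m → Fin m → Colour → Set
    Uniform x y c = ∀ a b → f a ≡ x → f b ≡ y → G a b ≡ c

    joinColour≼ : ∀ {x y c} → Uniform x y c → joinColour f x y ≼ just c
    joinColour≼ {x} {y} {c} uniform = ⨆-least (allFin N) λ a → ⨆-least (allFin N) (fibre≼ a)
      where
      fibre≼ : ∀ a b → fibreColour f x y a b ≼ just c
      fibre≼ a b with f a ≟ x | f b ≟ y
      ... | yes fa≡x | yes fb≡y =
        cong just (trans (cong (λ c′ → merge c′ c) (uniform a b fa≡x fb≡y)) (merge-idem c))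
      ... | yes _    | no _     = refl
      ... | no _     | _        = refl

    quotient-≢red : ∀ {x y c} → c ≢ red → Uniform x y c → quotient f x y ≢ red
    quotient-≢red {x} {y} c≢red uniform with x ≟ y
    ... | yes _ = λ ()
    ... | no _  = ≼just⇒≢red c≢red (joinColour≼ uniform)

    quotient-red : ∀ {x y a₁ b₁ a₂ b₂} → x ≢ y → f a₁ ≡ x → f b₁ ≡ y → f a₂ ≡ x → f b₂ ≡ y →
                   G a₁ b₁ ≡ black → G a₂ b₂ ≡ none → quotient f x y ≡ red
    quotient-red x≢y fa₁ fb₁ fa₂ fb₂ black₁ none₂ = trans (quotient-≢ x≢y)
      (cong (fromMaybe none) (black≼∧none≼⇒≡red
        (subst (λ c → just c ≼ joinColour f _ _) black₁ (G≼joinColour fa₁ fb₁))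
        (subst (λ c → just c ≼ joinColour f _ _) none₂ (G≼joinColour fa₂ fb₂))))

    quotient-≢red⁻ : (∀ a b → G a b ≢ red) → ∀ {x y a₁ a₂ b} → x ≢ y → quotient f x y ≢ red →
                     f a₁ ≡ x → f a₂ ≡ x → f b ≡ y → G a₁ b ≡ G a₂ b
    quotient-≢red⁻ noRed {a₁ = a₁} {a₂} {b} x≢y ≢red fa₁ fa₂ fb with G a₁ b in e₁ | G a₂ b in e₂
    ... | none  | none  = refl
    ... | black | black = refl
    ... | red   | _     = ⊥-elim (noRed a₁ b e₁)
    ... | _     | red   = ⊥-elim (noRed a₂ b e₂)
    ... | black | none  = ⊥-elim (≢red (quotient-red x≢y fa₁ fb fa₂ fb e₁ e₂))
    ... | none  | black = ⊥-elim (≢red (quotient-red x≢y fa₂ fb fa₁ fb e₂ e₁))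

  quotient-id : (∀ a → G a a ≡ none) → (∀ a b → G a b ≢ red) → quotient (λ a → a) ≈ᵀ G
  quotient-id loopless noRed x y with x ≟ y
  ... | yes refl = sym (loopless x)
  ... | no _     = cong (fromMaybe none) (≼-antisym
    (joinColour≼ (λ a → a) λ where _ _ refl refl → refl) (G≼joinColour (λ a → a) refl refl))

  module _ {m : ℕ} (f : Fin N → Fin (suc (suc m))) (onto : Onto f)
           {u v : Fin (suc (suc m))} (u≢v : u ≢ v) where
    open Collapse u≢v

    collapse-onto : Onto (collapse ∘ f)
    collapse-onto z = let a , fa≡ = onto (punchIn v z) in a , trans (cong collapse fa≡) (collapse-punchIn z)

    private
      f′ = collapse ∘ f

      joinColour≢nothing : ∀ x y → joinColour f x y ≢ nothing
      joinColour≢nothing x y = just≼⇒≢nothing (G≼joinColour f (proj₂ (onto x)) (proj₂ (onto y)))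

      does-collapse-punchIn : ∀ {x} → punchIn v x ≢ u → ∀ a → does (f′ a ≟ x) ≡ does (f a ≟ punchIn v x)
      does-collapse-punchIn x̂≢u a = does-⇔ (collapse-≡-punchIn x̂≢u (f a)) (f′ a ≟ _) (f a ≟ _)

      does-collapse-u : ∀ {x} → punchIn v x ≡ u → ∀ a → does (f′ a ≟ x) ≡ does (f a ≟ u) ∨ does (f a ≟ v)
      does-collapse-u x̂≡u a = does-⇔ (collapse-≡-u x̂≡u (f a)) (f′ a ≟ _) (f a ≟ u ⊎-dec f a ≟ v)

      joinColour-collapse : ∀ {x y} → punchIn v x ≢ u → punchIn v y ≢ u →
                            joinColour f′ x y ≡ joinColour f (punchIn v x) (punchIn v y)
      joinColour-collapse x̂≢u ŷ≢u = ⨆-cong (allFin N) λ a → ⨆-cong (allFin N) λ b →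
        cong₂ (λ p q → when (p ∧ q) (G a b)) (does-collapse-punchIn x̂≢u a) (does-collapse-punchIn ŷ≢u b)

      joinColour-collapseˡ : ∀ {x y} → punchIn v x ≡ u → punchIn v y ≢ u →
        joinColour f′ x y ≡ joinColour f u (punchIn v y) ⊔ joinColour f v (punchIn v y)
      joinColour-collapseˡ {y = y} x̂≡u ŷ≢u = ⨆-distrib-⊔ (allFin N) λ a → ⨆-distrib-⊔ (allFin N) λ b →
        trans (cong₂ (λ p q → when (p ∧ q) (G a b)) (does-collapse-u x̂≡u a) (does-collapse-punchIn ŷ≢u b))
              (when-∨ˡ (does (f a ≟ u)) (does (f a ≟ v)) (does (f b ≟ punchIn v y)) (G a b))

      joinColour-collapseʳ : ∀ {x y} → punchIn v x ≢ u → punchIn v y ≡ u →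
        joinColour f′ x y ≡ joinColour f (punchIn v x) u ⊔ joinColour f (punchIn v x) v
      joinColour-collapseʳ {x = x} x̂≢u ŷ≡u = ⨆-distrib-⊔ (allFin N) λ a → ⨆-distrib-⊔ (allFin N) λ b →
        trans (cong₂ (λ p q → when (p ∧ q) (G a b)) (does-collapse-punchIn x̂≢u a) (does-collapse-u ŷ≡u b))
              (when-∨ʳ (does (f b ≟ u)) (does (f b ≟ v)) (does (f a ≟ punchIn v x)) (G a b))

      merge-quotient : ∀ {x₁ y₁ x₂ y₂} → x₁ ≢ y₁ → x₂ ≢ y₂ →
        merge (quotient f x₁ y₁) (quotient f x₂ y₂) ≡ fromMaybe none (joinColour f x₁ y₁ ⊔ joinColour f x₂ y₂)
      merge-quotient x₁≢y₁ x₂≢y₂ = trans (cong₂ merge (quotient-≢ f x₁≢y₁) (quotient-≢ f x₂≢y₂))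
        (sym (fromMaybe-⊔ (joinColour≢nothing _ _) (joinColour≢nothing _ _)))

    contract-quotient : contract (quotient f) u v ≈ᵀ quotient f′
    contract-quotient x y with punchIn v x ≟ u | punchIn v y ≟ u
    ... | yes x̂≡u | yes ŷ≡u with punchIn-injective v x y (trans x̂≡u (sym ŷ≡u))
    ...   | refl = sym (quotient-diag f′ x)
    contract-quotient x y | yes x̂≡u | no ŷ≢u =
      trans (merge-quotient (ŷ≢u ∘ sym) (punchInᵢ≢i v y ∘ sym))
      (trans (cong (fromMaybe none) (sym (joinColour-collapseˡ x̂≡u ŷ≢u)))
             (sym (quotient-≢ f′ λ where refl → ŷ≢u x̂≡u)))
    contract-quotient x y | no x̂≢u | yes ŷ≡u =
      trans (merge-quotient x̂≢u (punchInᵢ≢i v x))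
      (trans (cong (fromMaybe none) (sym (joinColour-collapseʳ x̂≢u ŷ≡u)))
             (sym (quotient-≢ f′ λ where refl → x̂≢u ŷ≡u)))
    contract-quotient x y | no x̂≢u | no ŷ≢u = case x ≟ y of λ where
      (yes refl) → trans (quotient-diag f (punchIn v x)) (sym (quotient-diag f′ x))
      (no x≢y)   → trans (quotient-≢ f (x≢y ∘ punchIn-injective v x y))
        (trans (cong (fromMaybe none) (sym (joinColour-collapse x̂≢u ŷ≢u))) (sym (quotient-≢ f′ x≢y)))

    contract-≈quotient : ∀ {T} → T ≈ᵀ quotient f → contract T u v ≈ᵀ quotient f′
    contract-≈quotient {T} T≈ x y = trans (contract-cong {T = T} u v T≈ x y) (contract-quotient x y)

  Covered : ∀ {m} → (Fin N → Fin m) → List (Fin N) → Fin N → Fin N → Set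
  Covered f L a b = (Σ (Fin N) λ l → l ∈ L × f l ≡ f b) ⊎ (Σ Colour λ c → c ≢ red × Uniform f (f a) (f b) c)

  FewRedParts : ∀ {m} → (Fin N → Fin m) → ℕ → Fin N → Set
  FewRedParts f d a = Σ (List (Fin N)) λ L → length L ≤ d × (∀ b → Covered f L a b)

  FewRedParts⇒RedBounded : ∀ {m d} {f : Fin N → Fin m} → Onto f → (∀ a → FewRedParts f d a) →
                           RedBounded d (quotient f)
  FewRedParts⇒RedBounded {f = f} onto few x with onto x
  ... | a , refl with few a
  ... | L , |L|≤d , parts =
    ≤-trans (redDeg≤length (quotient f) (f a) red⇒∈) (≤-trans (≤-reflexive (length-map f L)) |L|≤d)
    where
    red⇒∈ : ∀ y → quotient f (f a) y ≡ red → y ∈ map f L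
    red⇒∈ y r with onto y
    ... | b , refl with parts b
    ... | inj₁ (l , l∈L , fl≡fb) = subst (_∈ map f L) fl≡fb (∈-map⁺ f l∈L)
    ... | inj₂ (c , c≢red , uniform) = ⊥-elim (quotient-≢red f c≢red uniform r)

  record Realises {m} (K : Fin N → ℕ) (f : Fin N → Fin m) : Set where
    field
      sameKey  : ∀ {a b} → f a ≡ f b → K a ≡ K b
      samePart : ∀ {a b} → K a ≡ K b → f a ≡ f b

  module _ (d : ℕ) where

    Contractible : (Fin N → ℕ) → Set
    Contractible K = ∀ {m} (T : Trigraph m) (f : Fin N → Fin m) →
                     Onto f → T ≈ᵀ quotient f → Realises K f → ContractionSeq d T

    QuotientBounded : (Fin N → ℕ) → Set
    QuotientBounded K = ∀ {m} (f : Fin N → Fin m) → Onto f → Realises K f → RedBounded d (quotient f)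

    -- K′ is K with the singleton class {b₀} moved into the class of a₀.
    Contractible-step : ∀ {K K′ : Fin N → ℕ} {a₀ b₀} → K a₀ ≢ K b₀ → (∀ c → K c ≡ K b₀ → c ≡ b₀) →
                        K′ b₀ ≡ K a₀ → (∀ c → c ≢ b₀ → K′ c ≡ K c) →
                        QuotientBounded K → Contractible K′ → Contractible K
    Contractible-step {a₀ = a₀} _ _ _ _ _ _ {zero} T f _ _ _ = case f a₀ of λ ()
    Contractible-step {a₀ = a₀} {b₀} Ka₀≢Kb₀ _ _ _ _ _ {suc zero} T f _ _ r =
      ⊥-elim (Ka₀≢Kb₀ (Realises.sameKey r (Fin1-≡ (f a₀) (f b₀))))
    Contractible-step {K} {K′} {a₀} {b₀} Ka₀≢Kb₀ b₀-alone K′b₀ K′≡K bounded contractible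
                      {suc (suc m)} T f onto T≈ r =
      step T (RedBounded-cong (λ x y → sym (T≈ x y)) (bounded f onto r)) (f a₀) (f b₀) u≢v
        (contractible _ (collapse ∘ f) (collapse-onto f onto u≢v)
          (contract-≈quotient f onto u≢v T≈)
          (record { sameKey = sameKey′ ; samePart = samePart′ }))
      where
      open Realises r
      u≢v : f a₀ ≢ f b₀
      u≢v = Ka₀≢Kb₀ ∘ sameKey
      open Collapse u≢v

      K′-resp : ∀ {a b} → K a ≡ K b → K′ a ≡ K′ b
      K′-resp {a} {b} Ka≡Kb with a ≟ b₀ | b ≟ b₀
      ... | yes refl | yes refl = refl
      ... | yes refl | no b≢b₀  = ⊥-elim (b≢b₀ (b₀-alone b (sym Ka≡Kb)))
      ... | no a≢b₀  | yes refl = ⊥-elim (a≢b₀ (b₀-alone a Ka≡Kb))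
      ... | no a≢b₀  | no b≢b₀  = trans (K′≡K a a≢b₀) (trans Ka≡Kb (sym (K′≡K b b≢b₀)))

      K′-a₀ : ∀ {a} → K a ≡ K a₀ → K′ a ≡ K′ b₀
      K′-a₀ {a} Ka≡Ka₀ = trans (K′≡K a a≢b₀) (trans Ka≡Ka₀ (sym K′b₀))
        where
        a≢b₀ : a ≢ b₀
        a≢b₀ refl = Ka₀≢Kb₀ (sym Ka≡Ka₀)

      sameKey′ : ∀ {a b} → collapse (f a) ≡ collapse (f b) → K′ a ≡ K′ b
      sameKey′ {a} {b} eq with collapse-≡⁻ eq
      ... | inj₁ fa≡fb = K′-resp (sameKey fa≡fb)
      ... | inj₂ (inj₁ (fa≡u , fb≡v)) rewrite b₀-alone b (sameKey fb≡v) = K′-a₀ (sameKey fa≡u)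
      ... | inj₂ (inj₂ (fa≡v , fb≡u)) rewrite b₀-alone a (sameKey fa≡v) = sym (K′-a₀ (sameKey fb≡u))

      samePart′ : ∀ {a b} → K′ a ≡ K′ b → collapse (f a) ≡ collapse (f b)
      samePart′ {a} {b} eq with a ≟ b₀ | b ≟ b₀
      ... | yes refl | yes refl = refl
      ... | yes refl | no b≢b₀  =
        trans (sym collapse-u≡v) (cong collapse (samePart (trans (sym K′b₀) (trans eq (K′≡K b b≢b₀)))))
      ... | no a≢b₀  | yes refl =
        trans (cong collapse (samePart (trans (sym (K′≡K a a≢b₀)) (trans eq K′b₀)))) collapse-u≡v
      ... | no a≢b₀  | no b≢b₀  = cong collapse (samePart (trans (sym (K′≡K a a≢b₀)) (trans eq (K′≡K b b≢b₀))))

    Contractible-few : ∀ {K} (L : List (Fin N)) → length L ≤ d → (∀ a → Σ (Fin N) λ l → l ∈ L × K l ≡ K a) →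
                       Fin N → Contractible K
    Contractible-few L |L|≤d reps a₀ {zero} T f _ _ _ = case f a₀ of λ ()
    Contractible-few L |L|≤d reps a₀ {suc m} T f onto _ r = order≤⇒ContractionSeq T (≤-trans m≤|L| |L|≤d)
      where
      covered : allFin (suc m) ⊆ map f L
      covered {z} _ with onto z
      ... | a , refl with reps a
      ... | l , l∈L , Kl≡Ka = subst (_∈ map f L) (Realises.samePart r Kl≡Ka) (∈-map⁺ f l∈L)
      m≤|L| : suc m ≤ length L
      m≤|L| = ≤-trans (≤-reflexive (sym (length-tabulate {n = suc m} (λ i → i))))
        (≤-trans (Unique∧⊆⇒length≤ (Unique.allFin⁺ (suc m)) covered) (≤-reflexive (length-map f L)))


-- The universal bipartite graph

colourOf : Bool → Colour
colourOf b = if b then black else none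

colourOf-injective : ∀ {b b′} → colourOf b ≡ colourOf b′ → b ≡ b′
colourOf-injective {false} {false} _ = refl
colourOf-injective {true}  {true}  _ = refl

module UniversalBipartite (n : ℕ) where

  𝓑 : Trigraph (n + 2 ^ n)
  𝓑 = universalBipartite n

  element : Fin n → Fin (n + 2 ^ n)
  element k = k ↑ˡ 2 ^ n

  subset : Fin (2 ^ n) → Fin (n + 2 ^ n)
  subset s = n ↑ʳ s

  data Kind : Fin (n + 2 ^ n) → Set where
    isElement : ∀ k → Kind (element k)
    isSubset  : ∀ s → Kind (subset s)

  kind : ∀ a → Kind a
  kind a with splitAt n a in eq
  ... | inj₁ k = subst Kind (splitAt⁻¹-↑ˡ eq) (isElement k)
  ... | inj₂ s = subst Kind (splitAt⁻¹-↑ʳ eq) (isSubset s)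

  𝓑-element-subset : ∀ k s → 𝓑 (element k) (subset s) ≡ memberColour (toℕ k) (toℕ s)
  𝓑-element-subset k s rewrite splitAt-↑ˡ n k (2 ^ n) | splitAt-↑ʳ n (2 ^ n) s = refl

  𝓑-subset-element : ∀ k s → 𝓑 (subset s) (element k) ≡ memberColour (toℕ k) (toℕ s)
  𝓑-subset-element k s rewrite splitAt-↑ˡ n k (2 ^ n) | splitAt-↑ʳ n (2 ^ n) s = refl

  𝓑-element-element : ∀ k l → 𝓑 (element k) (element l) ≡ none
  𝓑-element-element k l rewrite splitAt-↑ˡ n k (2 ^ n) | splitAt-↑ˡ n l (2 ^ n) = refl

  𝓑-subset-subset : ∀ s r → 𝓑 (subset s) (subset r) ≡ none
  𝓑-subset-subset s r rewrite splitAt-↑ʳ n (2 ^ n) s | splitAt-↑ʳ n (2 ^ n) r = refl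

  memberColour-≢red : ∀ k s → memberColour k s ≢ red
  memberColour-≢red k s with testBit s k
  ... | true  = λ ()
  ... | false = λ ()

  𝓑-≢red : ∀ a b → 𝓑 a b ≢ red
  𝓑-≢red a b with kind a | kind b
  ... | isElement k | isElement l = subst (_≢ red) (sym (𝓑-element-element k l)) λ ()
  ... | isElement k | isSubset s  = subst (_≢ red) (sym (𝓑-element-subset k s)) (memberColour-≢red (toℕ k) (toℕ s))
  ... | isSubset s  | isElement k = subst (_≢ red) (sym (𝓑-subset-element k s)) (memberColour-≢red (toℕ k) (toℕ s))
  ... | isSubset s  | isSubset r  = subst (_≢ red) (sym (𝓑-subset-subset s r)) λ ()

  𝓑-loopless : ∀ a → 𝓑 a a ≡ none
  𝓑-loopless a with kind a
  ... | isElement k = 𝓑-element-element k k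
  ... | isSubset s  = 𝓑-subset-subset s s

  element≢subset : ∀ k s → element k ≢ subset s
  element≢subset k s eq
    with trans (sym (splitAt-↑ˡ n k (2 ^ n))) (trans (cong (splitAt n) eq) (splitAt-↑ʳ n (2 ^ n) s))
  ... | ()

  element-injective : ∀ {k l} → element k ≡ element l → k ≡ l
  element-injective = ↑ˡ-injective (2 ^ n) _ _

-- Binary expansions

bitValue : Bool → ℕ
bitValue false = 0
bitValue true  = 1

bitValue≤1 : ∀ b → bitValue b ≤ 1
bitValue≤1 false = z≤n
bitValue≤1 true  = s≤s z≤n

fromBits : ∀ {r} → Vec Bool r → ℕ
fromBits []       = 0
fromBits (b ∷ bs) = bitValue b + fromBits bs * 2

fromBits< : ∀ {r} (bs : Vec Bool r) → fromBits bs < 2 ^ r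
fromBits< []                = s≤s z≤n
fromBits< {suc r} (b ∷ bs) = begin-strict
  bitValue b + fromBits bs * 2 ≤⟨ +-monoˡ-≤ (fromBits bs * 2) (bitValue≤1 b) ⟩
  1 + fromBits bs * 2          <⟨ ≤-reflexive (cong (2 +_) (*-comm (fromBits bs) 2)) ⟩
  2 + 2 * fromBits bs          ≡⟨ *-suc 2 (fromBits bs) ⟨
  2 * suc (fromBits bs)        ≤⟨ *-monoʳ-≤ 2 (fromBits< bs) ⟩
  2 * 2 ^ r                    ∎
  where open ≤-Reasoning

fromBits-%2 : ∀ {r} b (bs : Vec Bool r) → fromBits (b ∷ bs) % 2 ≡ bitValue b
fromBits-%2 false bs = [m+kn]%n≡m%n 0 (fromBits bs) 2
fromBits-%2 true  bs = [m+kn]%n≡m%n 1 (fromBits bs) 2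

fromBits-/2 : ∀ {r} b (bs : Vec Bool r) → fromBits (b ∷ bs) / 2 ≡ fromBits bs
fromBits-/2 false bs = m*n/n≡m (fromBits bs) 2
fromBits-/2 true  bs =
  trans (+-distrib-/-∣ʳ 1 {fromBits bs * 2} {2} (divides (fromBits bs) refl)) (m*n/n≡m (fromBits bs) 2)

testBit-fromBits : ∀ {r} (bs : Vec Bool r) (j : Fin r) → testBit (fromBits bs) (toℕ j) ≡ lookup bs j
testBit-fromBits (false ∷ bs) Fin.zero    = cong (_≡ᵇ 1) (fromBits-%2 false bs)
testBit-fromBits (true  ∷ bs) Fin.zero    = cong (_≡ᵇ 1) (fromBits-%2 true bs)
testBit-fromBits (b ∷ bs)     (Fin.suc j) =
  trans (cong (λ s → testBit s (toℕ j)) (fromBits-/2 b bs)) (testBit-fromBits bs j)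

lowBits : ℕ → ℕ → ℕ
lowBits t s = _%_ s (2 ^ t) {{m^n≢0 2 t}}

lowBits< : ∀ t s → lowBits t s < 2 ^ t
lowBits< t s = m%n<n s (2 ^ t) {{m^n≢0 2 t}}

lowBits-id : ∀ {t s} → s < 2 ^ t → lowBits t s ≡ s
lowBits-id {t} = m<n⇒m%n≡m {{m^n≢0 2 t}}

testBit-lowBits : ∀ {e t} s → e < t → testBit (lowBits t s) e ≡ testBit s e
testBit-lowBits {zero} {suc t} s _ =
  cong (_≡ᵇ 1) (m∣n⇒o%n%m≡o%m 2 (2 ^ suc t) s {{_}} {{m^n≢0 2 (suc t)}} (divides (2 ^ t) (*-comm 2 (2 ^ t))))
testBit-lowBits {suc e} {suc t} s (s≤s e<t) = trans (cong (λ z → testBit z e) halve) (testBit-lowBits (s / 2) e<t)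
  where
  instance
    _ = m^n≢0 2 t
    _ = m^n≢0 2 (suc t)
    _ = m*n≢0 (2 ^ t) 2
  halve : s % 2 ^ suc t / 2 ≡ s / 2 % 2 ^ t
  halve = trans (/-congˡ (%-congʳ (*-comm 2 (2 ^ t)))) (m%[n*o]/o≡m/o%n s (2 ^ t) 2)

allBoolVecs : ∀ r → List (Vec Bool r)
allBoolVecs zero    = [ [] ]
allBoolVecs (suc r) = map (true ∷_) (allBoolVecs r) ++ map (false ∷_) (allBoolVecs r)

length-allBoolVecs : ∀ r → length (allBoolVecs r) ≡ 2 ^ r
length-allBoolVecs zero    = refl
length-allBoolVecs (suc r) = begin
  length (map (true ∷_) (allBoolVecs r) ++ map (false ∷_) (allBoolVecs r))
    ≡⟨ length-++ (map (true ∷_) (allBoolVecs r)) ⟩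
  length (map (true ∷_) (allBoolVecs r)) + length (map (false ∷_) (allBoolVecs r))
    ≡⟨ cong₂ _+_ (length-map _ (allBoolVecs r)) (length-map _ (allBoolVecs r)) ⟩
  length (allBoolVecs r) + length (allBoolVecs r)
    ≡⟨ cong₂ _+_ (length-allBoolVecs r) (trans (length-allBoolVecs r) (sym (+-identityʳ _))) ⟩
  2 ^ suc r ∎
  where open ≡-Reasoning

∈-allBoolVecs : ∀ {r} (bs : Vec Bool r) → bs ∈ allBoolVecs r
∈-allBoolVecs []                 = here refl
∈-allBoolVecs {suc r} (true ∷ bs)  = ∈-++⁺ˡ (∈-map⁺ (true ∷_) (∈-allBoolVecs bs))
∈-allBoolVecs {suc r} (false ∷ bs) = ∈-++⁺ʳ (map (true ∷_) (allBoolVecs r)) (∈-map⁺ (false ∷_) (∈-allBoolVecs bs))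

allBoolVecs-Unique : ∀ r → Unique (allBoolVecs r)
allBoolVecs-Unique zero    = All.[] ∷ []
allBoolVecs-Unique (suc r) =
  Unique.++⁺ (Unique.map⁺ Vec.∷-injectiveʳ (allBoolVecs-Unique r))
             (Unique.map⁺ Vec.∷-injectiveʳ (allBoolVecs-Unique r)) disjoint
  where
  disjoint : ∀ {bs} → bs ∈ map (true ∷_) (allBoolVecs r) × bs ∈ map (false ∷_) (allBoolVecs r) → ⊥
  disjoint (t∈ , f∈) with ∈-map⁻ (true ∷_) t∈ | ∈-map⁻ (false ∷_) f∈
  ... | _ , _ , refl | _ , _ , ()

boolListsUpTo : ℕ → List (List Bool)
boolListsUpTo zero    = [ [] ]
boolListsUpTo (suc d) = [] ∷ map (true ∷_) (boolListsUpTo d) ++ map (false ∷_) (boolListsUpTo d)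

length-boolListsUpTo< : ∀ d → length (boolListsUpTo d) < 2 ^ suc d
length-boolListsUpTo< zero    = s≤s (s≤s z≤n)
length-boolListsUpTo< (suc d) = begin-strict
  suc (length (map (true ∷_) L ++ map (false ∷_) L))
    ≡⟨ cong suc (trans (length-++ (map (true ∷_) L)) (cong₂ _+_ (length-map _ L) (length-map _ L))) ⟩
  suc (length L + length L) <⟨ s≤s (≤-reflexive (sym (+-suc (length L) (length L)))) ⟩
  suc (length L) + suc (length L) ≤⟨ +-mono-≤ (length-boolListsUpTo< d) (length-boolListsUpTo< d) ⟩
  2 ^ suc d + 2 ^ suc d ≡⟨ cong (2 ^ suc d +_) (sym (+-identityʳ _)) ⟩
  2 ^ suc (suc d) ∎
  where
  open ≤-Reasoning
  L = boolListsUpTo d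

∈-boolListsUpTo : ∀ d (bs : List Bool) → length bs ≤ d → bs ∈ boolListsUpTo d
∈-boolListsUpTo zero    []           _         = here refl
∈-boolListsUpTo (suc d) []           _         = here refl
∈-boolListsUpTo (suc d) (true ∷ bs)  (s≤s |bs|≤d) = there (∈-++⁺ˡ (∈-map⁺ (true ∷_) (∈-boolListsUpTo d bs |bs|≤d)))
∈-boolListsUpTo (suc d) (false ∷ bs) (s≤s |bs|≤d) =
  there (∈-++⁺ʳ (map (true ∷_) (boolListsUpTo d)) (∈-map⁺ (false ∷_) (∈-boolListsUpTo d bs |bs|≤d)))

Vec-ext : ∀ {r} {xs ys : Vec A r} → (∀ i → lookup xs i ≡ lookup ys i) → xs ≡ ys
Vec-ext {xs = xs} {ys} pointwise =
  trans (sym (tabulate∘lookup xs)) (trans (tabulate-cong pointwise) (tabulate∘lookup ys))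

module Separating {n : ℕ} {k l : Fin n} (k≢l : k ≢ l) where

  Separates : Vec Bool n → Set
  Separates bs = lookup bs k ≡ true × lookup bs l ≡ false

  separates? : ∀ bs → Dec (Separates bs)
  separates? bs = (lookup bs k Bool.≟ true) ×-dec (lookup bs l Bool.≟ false)

  separating : List (Vec Bool n)
  separating = filter separates? (allBoolVecs n)

  separating-Unique : Unique separating
  separating-Unique = Unique.filter⁺ separates? (allBoolVecs-Unique n)

  ∈separating⇒Separates : ∀ {bs} → bs ∈ separating → Separates bs
  ∈separating⇒Separates bs∈ = proj₂ (∈-filter⁻ separates? {xs = allBoolVecs n} bs∈)

  separate : Vec Bool n → Vec Bool n
  separate bs = (bs [ k ]≔ true) [ l ]≔ false

  separate-Separates : ∀ bs → Separates (separate bs)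
  separate-Separates bs = trans (lookup∘update′ k≢l (bs [ k ]≔ true) false) (lookup∘update k bs true) ,
                          lookup∘update l (bs [ k ]≔ true) false

  lookup-separate : ∀ bs {i} → i ≢ k → i ≢ l → lookup (separate bs) i ≡ lookup bs i
  lookup-separate bs i≢k i≢l = trans (lookup∘update′ i≢l (bs [ k ]≔ true) false) (lookup∘update′ i≢k bs true)

  2^n≤|separating|*4 : 2 ^ n ≤ length separating * 4
  2^n≤|separating|*4 = begin
    2 ^ n                  ≡⟨ length-allBoolVecs n ⟨
    length (allBoolVecs n) ≤⟨ injectiveOn⇒length≤ encode (allBoolVecs-Unique n) (λ _ _ → encode-injective) encode∈ ⟩
    length (cartesianProduct separating (cartesianProduct bools bools))
      ≡⟨ trans (length-cartesianProduct separating _)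
               (cong (length separating *_) (length-cartesianProduct bools bools)) ⟩
    length separating * 4  ∎
    where
    open ≤-Reasoning
    encode : Vec Bool n → Vec Bool n × Bool × Bool
    encode bs = separate bs , lookup bs k , lookup bs l
    encode-injective : ∀ {bs bs′} → encode bs ≡ encode bs′ → bs ≡ bs′
    encode-injective {bs} {bs′} eq = Vec-ext λ i → case ((i ≟ k) ,′ (i ≟ l)) of λ where
      (yes refl , _)      → cong (proj₁ ∘ proj₂) eq
      (no _ , yes refl)   → cong (proj₂ ∘ proj₂) eq
      (no i≢k , no i≢l)   → trans (sym (lookup-separate bs i≢k i≢l))
        (trans (cong (λ e → lookup (proj₁ e) i) eq) (lookup-separate bs′ i≢k i≢l))
    bools : List Bool
    bools = true ∷ false ∷ []
    ∈bools : ∀ b → b ∈ bools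
    ∈bools true  = here refl
    ∈bools false = there (here refl)
    encode∈ : ∀ {bs} → bs ∈ allBoolVecs n → encode bs ∈ cartesianProduct separating (cartesianProduct bools bools)
    encode∈ {bs} _ = ∈-cartesianProduct⁺
      (∈-filter⁺ separates? (∈-allBoolVecs (separate bs)) (separate-Separates bs))
      (∈-cartesianProduct⁺ (∈bools _) (∈bools _))

-- The lower bound

module LowerBound (n d : ℕ) {k₀ k₁ : Fin n} (k₀≢k₁ : k₀ ≢ k₁) where
  open UniversalBipartite n
  open Quotient 𝓑

  ElementsApart : ∀ {m} → (Fin (n + 2 ^ n) → Fin m) → Set
  ElementsApart f = ∀ k b → f b ≡ f (element k) → b ≡ element k

  another : (k : Fin n) → Σ (Fin n) (k ≢_)
  another k = case k ≟ k₀ of λ where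
    (yes refl) → k₁ , k₀≢k₁
    (no k≢k₀)  → k₀ , k≢k₀

  subsetOf : Vec Bool n → Fin (n + 2 ^ n)
  subsetOf bs = subset (fromℕ< (fromBits< bs))

  testBit-subsetOf : ∀ (j : Fin n) (bs : Vec Bool n) → testBit (toℕ (fromℕ< (fromBits< bs))) (toℕ j) ≡ lookup bs j
  testBit-subsetOf j bs = trans (cong (λ s → testBit s (toℕ j)) (toℕ-fromℕ< (fromBits< bs))) (testBit-fromBits bs j)

  𝓑-element-subsetOf : ∀ (j : Fin n) (bs : Vec Bool n) → 𝓑 (element j) (subsetOf bs) ≡ colourOf (lookup bs j)
  𝓑-element-subsetOf j bs = trans (𝓑-element-subset j _) (cong colourOf (testBit-subsetOf j bs))

  𝓑-subsetOf-element : ∀ (j : Fin n) (bs : Vec Bool n) → 𝓑 (subsetOf bs) (element j) ≡ colourOf (lookup bs j)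
  𝓑-subsetOf-element j bs = trans (𝓑-subset-element j _) (cong colourOf (testBit-subsetOf j bs))

  -- the first contraction that merges the (singleton) part of an element vertex
  module FirstElementMerge {m} (T : Trigraph (suc (suc m))) (f : Fin (n + 2 ^ n) → Fin (suc (suc m)))
                           (onto : Onto f) (T≈ : T ≈ᵀ quotient f) (apart : ElementsApart f)
                           (bounded : RedBounded d T) {u v} (u≢v : u ≢ v)
                           (bounded′ : RedBounded d (contract T u v))
                           (k : Fin n) (k∈u∪v : f (element k) ≡ u ⊎ f (element k) ≡ v) where
    open Collapse u≢v

    f′ : Fin (n + 2 ^ n) → Fin (suc m)
    f′ = collapse ∘ f

    x : Fin (suc m)
    x = collapse u

    T′≈ : contract T u v ≈ᵀ quotient f′
    T′≈ = contract-≈quotient f onto u≢v T≈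

    f′-element-k : f′ (element k) ≡ x
    f′-element-k = [ cong collapse , (λ k∈v → trans (cong collapse k∈v) (sym collapse-u≡v)) ]′ k∈u∪v

    partner : Σ (Fin (n + 2 ^ n)) λ c → f′ c ≡ x × f c ≢ f (element k)
    partner = [ (λ k∈u → let c , fc≡v = onto v in
                  c , trans (cong collapse fc≡v) (sym collapse-u≡v) ,
                  λ fc≡ → u≢v (trans (sym k∈u) (trans (sym fc≡) fc≡v)))
              , (λ k∈v → let c , fc≡u = onto u in
                  c , cong collapse fc≡u , λ fc≡ → u≢v (trans (sym fc≡u) (trans fc≡ k∈v))) ]′ k∈u∪v

    c : Fin (n + 2 ^ n)
    c = proj₁ partner

    f′-c : f′ c ≡ x
    f′-c = proj₁ (proj₂ partner)

    nonNeighbour : ∀ a → f a ≢ f (element k) →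
                   Σ (Fin n) λ l → k ≢ l × (∀ bs → lookup bs l ≡ false → 𝓑 a (subsetOf bs) ≡ none)
    nonNeighbour a fa≢ with kind a
    ... | isElement l = l , (λ where refl → fa≢ refl) ,
                        λ bs bit → trans (𝓑-element-subsetOf l bs) (cong colourOf bit)
    ... | isSubset s  = let l , k≢l = another k in l , k≢l , λ bs _ → 𝓑-subset-subset s _

    l : Fin n
    l = proj₁ (nonNeighbour c (proj₂ (proj₂ partner)))

    k≢l : k ≢ l
    k≢l = proj₁ (proj₂ (nonNeighbour c (proj₂ (proj₂ partner))))

    c-nonNeighbour : ∀ bs → lookup bs l ≡ false → 𝓑 c (subsetOf bs) ≡ none
    c-nonNeighbour = proj₂ (proj₂ (nonNeighbour c (proj₂ (proj₂ partner))))

    open Separating k≢l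

    redElements : Fin (suc (suc m)) → List (Fin n)
    redElements P = filter (λ j → isRed (T P (f (element j)))) (allFin n)

    |redElements|≤d : ∀ P → length (redElements P) ≤ d
    |redElements|≤d P = begin
      length (redElements P)                       ≡⟨ length-map (f ∘ element) (redElements P) ⟨
      length (map (f ∘ element) (redElements P))   ≤⟨ length≤redDeg T P unique allRed ⟩
      redDeg T P                                   ≤⟨ bounded P ⟩
      d                                            ∎
      where
      open ≤-Reasoning
      unique : Unique (map (f ∘ element) (redElements P))
      unique = Unique-map⁺ (f ∘ element) (λ {i} {j} _ _ eq → element-injective (apart j (element i) eq))
        (Unique.filter⁺ (λ j → isRed (T P (f (element j)))) {xs = allFin n} (Unique.allFin⁺ n))
      allRed : ∀ {y} → y ∈ map (f ∘ element) (redElements P) → T P y ≡ red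
      allRed y∈ with ∈-map⁻ (f ∘ element) y∈
      ... | j , j∈ , refl = proj₂ (∈-filter⁻ (λ j → isRed (T P (f (element j)))) {xs = allFin n} j∈)

    redNeighbours : List (Fin (suc m))
    redNeighbours = filter (λ y → isRed (contract T u v x y)) (allFin (suc m))

    encode : Vec Bool n → Fin (suc m) × List Bool
    encode bs = f′ (subsetOf bs) , map (lookup bs) (redElements (f (subsetOf bs)))

    encode∈ : ∀ {bs} → bs ∈ separating → encode bs ∈ cartesianProduct (x ∷ redNeighbours) (boolListsUpTo d)
    encode∈ {bs} bs∈ = ∈-cartesianProduct⁺ part∈
      (∈-boolListsUpTo d _ (≤-trans (≤-reflexive (length-map (lookup bs) (redElements (f (subsetOf bs)))))
                                    (|redElements|≤d _)))
      where
      part∈ : f′ (subsetOf bs) ∈ x ∷ redNeighbours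
      part∈ with f′ (subsetOf bs) ≟ x
      ... | yes eq = here eq
      ... | no  ≢x = there (∈-filter⁺ (λ y → isRed (contract T u v x y)) (∈-allFin _)
        (trans (T′≈ x _) (quotient-red f′ (≢x ∘ sym) f′-element-k refl f′-c refl
          (trans (𝓑-element-subsetOf k bs) (cong colourOf (proj₁ (∈separating⇒Separates bs∈))))
          (c-nonNeighbour bs (proj₂ (∈separating⇒Separates bs∈))))))

    notElement : ∀ {bs} → f (subsetOf bs) ≢ f (element k)
    notElement eq = element≢subset k _ (sym (apart k _ eq))

    u∪v∋k : ∀ {a b} → (f a ≡ u × f b ≡ v) ⊎ (f a ≡ v × f b ≡ u) → f (element k) ≡ u ⊎ f (element k) ≡ v →
            f a ≡ f (element k) ⊎ f b ≡ f (element k)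
    u∪v∋k (inj₁ (a∈u , _))   (inj₁ k∈u) = inj₁ (trans a∈u (sym k∈u))
    u∪v∋k (inj₁ (_ , b∈v))   (inj₂ k∈v) = inj₂ (trans b∈v (sym k∈v))
    u∪v∋k (inj₂ (_ , b∈u))   (inj₁ k∈u) = inj₂ (trans b∈u (sym k∈u))
    u∪v∋k (inj₂ (a∈v , _))   (inj₂ k∈v) = inj₁ (trans a∈v (sym k∈v))

    subset-parts : ∀ {bs bs′} → f′ (subsetOf bs) ≡ f′ (subsetOf bs′) → f (subsetOf bs) ≡ f (subsetOf bs′)
    subset-parts {bs} {bs′} eq with collapse-≡⁻ eq
    ... | inj₁ same = same
    ... | inj₂ u∪v  = ⊥-elim ([ notElement {bs} , notElement {bs′} ]′ (u∪v∋k u∪v k∈u∪v))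

    -- all subsets in one part agree on the elements that are not red neighbours of the part
    lookup-≡ : ∀ {bs bs′} → f (subsetOf bs) ≡ f (subsetOf bs′) →
               map (lookup bs) (redElements (f (subsetOf bs))) ≡ map (lookup bs′) (redElements (f (subsetOf bs′))) →
               ∀ j → lookup bs j ≡ lookup bs′ j
    lookup-≡ {bs} {bs′} same patterns j with isRed (T (f (subsetOf bs)) (f (element j)))
    ... | yes P-j-red = map-≡⇒≡ (trans patterns (cong (λ Q → map (lookup bs′) (redElements Q)) (sym same)))
                                (∈-filter⁺ (λ j → isRed (T (f (subsetOf bs)) (f (element j)))) (∈-allFin j) P-j-red)
    ... | no P-j-≢red = colourOf-injective (begin
      colourOf (lookup bs j)        ≡⟨ 𝓑-subsetOf-element j bs ⟨
      𝓑 (subsetOf bs) (element j)   ≡⟨ quotient-≢red⁻ f 𝓑-≢red (λ e → element≢subset j _ (sym (apart j _ e)))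
                                         (P-j-≢red ∘ trans (T≈ _ _)) refl (sym same) refl ⟩
      𝓑 (subsetOf bs′) (element j)  ≡⟨ 𝓑-subsetOf-element j bs′ ⟩
      colourOf (lookup bs′ j)       ∎)
      where open ≡-Reasoning

    encode-injective : InjectiveOn encode separating
    encode-injective {bs} {bs′} _ _ eq =
      Vec-ext (lookup-≡ {bs} {bs′} (subset-parts {bs} {bs′} (cong proj₁ eq)) (cong proj₂ eq))

    2^n≤ : 2 ^ n ≤ (suc d * 2 ^ suc d) * 4
    2^n≤ = ≤-trans 2^n≤|separating|*4 (*-monoˡ-≤ 4 (begin
      length separating
        ≤⟨ injectiveOn⇒length≤ encode separating-Unique encode-injective encode∈ ⟩
      length (cartesianProduct (x ∷ redNeighbours) (boolListsUpTo d))
        ≡⟨ length-cartesianProduct (x ∷ redNeighbours) (boolListsUpTo d) ⟩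
      suc (redDeg (contract T u v) x) * length (boolListsUpTo d)
        ≤⟨ *-mono-≤ (s≤s (bounded′ x)) (<⇒≤ (length-boolListsUpTo< d)) ⟩
      suc d * 2 ^ suc d ∎))
      where open ≤-Reasoning

  2^n≤-from : ∀ {m} (T : Trigraph m) (f : Fin (n + 2 ^ n) → Fin m) → Onto f → T ≈ᵀ quotient f →
              ElementsApart f → ContractionSeq d T → 2 ^ n ≤ (suc d * 2 ^ suc d) * 4
  2^n≤-from T f onto T≈ apart (single _ _) =
    ⊥-elim (k₀≢k₁ (sym (element-injective (apart k₀ (element k₁) (Fin1-≡ _ _)))))
  2^n≤-from T f onto T≈ apart (step _ bounded u v u≢v seq)
    with any? (λ k → (f (element k) ≟ u) ⊎-dec (f (element k) ≟ v))
  ... | yes (k , k∈u∪v) =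
    FirstElementMerge.2^n≤ T f onto T≈ apart bounded u≢v (ContractionSeq⇒RedBounded seq) k k∈u∪v
  ... | no noElement =
    2^n≤-from _ (collapse ∘ f) (collapse-onto f onto u≢v) (contract-≈quotient f onto u≢v T≈) apart′ seq
    where
    open Collapse u≢v
    apart′ : ElementsApart (collapse ∘ f)
    apart′ k b eq with collapse-≡⁻ eq
    ... | inj₁ same                = apart k b same
    ... | inj₂ (inj₁ (_ , k∈v))    = ⊥-elim (noElement (k , inj₂ k∈v))
    ... | inj₂ (inj₂ (_ , k∈u))    = ⊥-elim (noElement (k , inj₁ k∈u))

  2^n≤ : ContractionSeq d (universalBipartite n) → 2 ^ n ≤ (suc d * 2 ^ suc d) * 4
  2^n≤ = 2^n≤-from 𝓑 (λ a → a) (λ a → a , refl) (λ x y → sym (quotient-id 𝓑-loopless 𝓑-≢red x y)) (λ _ _ eq → eq)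

-- The upper bound

module UpperBound (n t d : ℕ) (t<n : t < n)
                  (p≤d : 2 ^ t ≤ d) (n∸t≤d : n ∸ t ≤ d) (1+t+p≤d : suc t + 2 ^ t ≤ d) where
  open UniversalBipartite n
  open Quotient 𝓑

  p : ℕ
  p = 2 ^ t

  p≤2^n : p ≤ 2 ^ n
  p≤2^n = ^-monoʳ-≤ 2 (<⇒≤ t<n)

  -- vertices by number; out-of-range numbers give the junk vertex subset 0
  elementAt : ℕ → Fin (n + 2 ^ n)
  elementAt e with e <? n
  ... | yes e<n = element (fromℕ< e<n)
  ... | no _    = subset (fromℕ< (m^n>0 2 n))

  subsetAt : ℕ → Fin (n + 2 ^ n)
  subsetAt s with s <? 2 ^ n
  ... | yes s<2^n = subset (fromℕ< s<2^n)
  ... | no _      = subset (fromℕ< (m^n>0 2 n))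

  elementAt-< : ∀ {e} → e < n → Σ (Fin n) λ x → elementAt e ≡ element x × toℕ x ≡ e
  elementAt-< {e} e<n with e <? n
  ... | yes e<n′ = fromℕ< e<n′ , refl , toℕ-fromℕ< e<n′
  ... | no e≮n   = ⊥-elim (e≮n e<n)

  subsetAt-< : ∀ {s} → s < 2 ^ n → Σ (Fin (2 ^ n)) λ x → subsetAt s ≡ subset x × toℕ x ≡ s
  subsetAt-< {s} s<2^n with s <? 2 ^ n
  ... | yes s<2^n′ = fromℕ< s<2^n′ , refl , toℕ-fromℕ< s<2^n′
  ... | no s≮2^n   = ⊥-elim (s≮2^n s<2^n)

  elementAt-toℕ : ∀ x → elementAt (toℕ x) ≡ element x
  elementAt-toℕ x with elementAt-< (toℕ<n x)
  ... | y , eq , y≡x = trans eq (cong element (toℕ-injective y≡x))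

  subsetAt-toℕ : ∀ x → subsetAt (toℕ x) ≡ subset x
  subsetAt-toℕ x with subsetAt-< (toℕ<n x)
  ... | y , eq , y≡x = trans eq (cong subset (toℕ-injective y≡x))

  -- elements in [t, k) are merged into element t
  elementClass : ℕ → ℕ → ℕ
  elementClass k e with t ≤? e | e <? k
  ... | yes _ | yes _ = t
  ... | _     | _     = e

  elementClass-cases : ∀ k e → (t ≤ e × e < k × elementClass k e ≡ t) ⊎ (¬ (t ≤ e × e < k) × elementClass k e ≡ e)
  elementClass-cases k e with t ≤? e | e <? k
  ... | yes t≤e | yes e<k = inj₁ (t≤e , e<k , refl)
  ... | yes _   | no e≮k  = inj₂ ((λ (_ , e<k) → e≮k e<k) , refl)
  ... | no t≰e  | _       = inj₂ ((λ (t≤e , _) → t≰e t≤e) , refl)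

  elementClass-in : ∀ {k e} → t ≤ e → e < k → elementClass k e ≡ t
  elementClass-in {k} {e} t≤e e<k with elementClass-cases k e
  ... | inj₁ (_ , _ , eq) = eq
  ... | inj₂ (∉ , _)      = ⊥-elim (∉ (t≤e , e<k))

  elementClass-out : ∀ {k e} → ¬ (t ≤ e × e < k) → elementClass k e ≡ e
  elementClass-out {k} {e} ∉ with elementClass-cases k e
  ... | inj₁ (t≤e , e<k , _) = ⊥-elim (∉ (t≤e , e<k))
  ... | inj₂ (_ , eq)        = eq

  elementClass-< : ∀ k {e} → e < t → elementClass k e ≡ e
  elementClass-< k e<t = elementClass-out λ (t≤e , _) → <⇒≱ e<t t≤e

  elementClass<n : ∀ k {e} → e < n → elementClass k e < n
  elementClass<n k {e} e<n with elementClass-cases k e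
  ... | inj₁ (_ , _ , eq) = subst (_< n) (sym eq) t<n
  ... | inj₂ (_ , eq)     = subst (_< n) (sym eq) e<n

  elementClass-1+t : ∀ e → elementClass (suc t) e ≡ e
  elementClass-1+t e with elementClass-cases (suc t) e
  ... | inj₁ (t≤e , e<1+t , eq) = trans eq (≤-antisym t≤e (≤-pred e<1+t))
  ... | inj₂ (_ , eq)           = eq

  elementClass≡small : ∀ k {e e′} → e′ < t → elementClass k e ≡ e′ → e ≡ e′
  elementClass≡small k {e} e′<t eq with elementClass-cases k e
  ... | inj₁ (_ , _ , eq′) = ⊥-elim (<-irrefl (trans (sym eq) eq′) e′<t)
  ... | inj₂ (_ , eq′)     = trans (sym eq′) eq

  elementClass≡k : ∀ {k e} → t < k → elementClass k e ≡ k → e ≡ k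
  elementClass≡k {k} {e} t<k eq with elementClass-cases k e
  ... | inj₁ (_ , _ , e↦t) = ⊥-elim (<-irrefl (trans (sym e↦t) eq) t<k)
  ... | inj₂ (_ , e↦e)     = trans (sym e↦e) eq

  -- subsets below j are merged according to their t lowest bits
  subsetClass : ℕ → ℕ → ℕ
  subsetClass j s with s <? j
  ... | yes _ = lowBits t s
  ... | no _  = s

  subsetClass-< : ∀ {j s} → s < j → subsetClass j s ≡ lowBits t s
  subsetClass-< {j} {s} s<j with s <? j
  ... | yes _  = refl
  ... | no s≮j = ⊥-elim (s≮j s<j)

  subsetClass-≥ : ∀ {j s} → ¬ s < j → subsetClass j s ≡ s
  subsetClass-≥ {j} {s} s≮j with s <? j
  ... | yes s<j = ⊥-elim (s≮j s<j)
  ... | no _    = refl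

  subsetClass≡j : ∀ {j s} → p ≤ j → subsetClass j s ≡ j → s ≡ j
  subsetClass≡j {j} {s} p≤j eq = case s <? j of λ where
    (yes s<j) → ⊥-elim (<-irrefl (trans (sym (subsetClass-< s<j)) eq) (<-≤-trans (lowBits< t s) p≤j))
    (no s≮j)  → trans (sym (subsetClass-≥ s≮j)) eq

  subsetClass-≡ : ∀ {j s s′} → p ≤ j → subsetClass j s′ ≡ subsetClass j s →
                  (s′ < j × s < j × lowBits t s′ ≡ lowBits t s) ⊎ s′ ≡ s
  subsetClass-≡ {j} {s} {s′} p≤j eq = case ((s′ <? j) ,′ (s <? j)) of λ where
    (yes s′<j , yes s<j) → inj₁ (s′<j , s<j , trans (sym (subsetClass-< s′<j)) (trans eq (subsetClass-< s<j)))
    (no s′≮j  , no s≮j)  → inj₂ (trans (sym (subsetClass-≥ s′≮j)) (trans eq (subsetClass-≥ s≮j)))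
    (yes s′<j , no s≮j)  → ⊥-elim (s≮j (subst (_< j)
      (trans (sym (subsetClass-< s′<j)) (trans eq (subsetClass-≥ s≮j))) (<-≤-trans (lowBits< t s′) p≤j)))
    (no s′≮j  , yes s<j) → ⊥-elim (s′≮j (subst (_< j)
      (sym (trans (sym (subsetClass-≥ s′≮j)) (trans eq (subsetClass-< s<j)))) (<-≤-trans (lowBits< t s) p≤j)))

  key : ℕ → ℕ → Fin (n + 2 ^ n) → ℕ
  key j k a with splitAt n a
  ... | inj₁ e = elementClass k (toℕ e)
  ... | inj₂ s = n + subsetClass j (toℕ s)

  module _ {j k : ℕ} where

    key-element : ∀ x → key j k (element x) ≡ elementClass k (toℕ x)
    key-element x rewrite splitAt-↑ˡ n x (2 ^ n) = refl

    key-subset : ∀ s → key j k (subset s) ≡ n + subsetClass j (toℕ s)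
    key-subset s rewrite splitAt-↑ʳ n (2 ^ n) s = refl

    key-elementAt : ∀ {e} → e < n → key j k (elementAt e) ≡ elementClass k e
    key-elementAt e<n with elementAt-< e<n
    ... | x , eq , x≡e = trans (cong (key j k) eq) (trans (key-element x) (cong (elementClass k) x≡e))

    key-subsetAt : p ≤ j → ∀ {c} → c < p → key j k (subsetAt c) ≡ n + c
    key-subsetAt p≤j c<p with subsetAt-< (<-≤-trans c<p p≤2^n)
    ... | x , eq , x≡c = trans (cong (key j k) eq) (trans (key-subset x) (cong (n +_)
      (trans (cong (subsetClass j) x≡c) (trans (subsetClass-< (<-≤-trans c<p p≤j)) (lowBits-id {t} c<p)))))

    key-element≢key-subset : ∀ x s → key j k (element x) ≢ key j k (subset s)
    key-element≢key-subset x s eq = m+n≮m n _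
      (subst (_< n) (trans (sym (key-element x)) (trans eq (key-subset s))) (elementClass<n k (toℕ<n x)))

    key≡key-element : ∀ a x → key j k a ≡ key j k (element x) →
                      Σ (Fin n) λ y → a ≡ element y × elementClass k (toℕ y) ≡ elementClass k (toℕ x)
    key≡key-element a x eq with kind a
    ... | isElement y = y , refl , trans (sym (key-element y)) (trans eq (key-element x))
    ... | isSubset s  = ⊥-elim (key-element≢key-subset x s (sym eq))

    key≡key-subset : ∀ a s → key j k a ≡ key j k (subset s) →
                     Σ (Fin (2 ^ n)) λ s′ → a ≡ subset s′ × subsetClass j (toℕ s′) ≡ subsetClass j (toℕ s)
    key≡key-subset a s eq with kind a
    ... | isSubset s′ = s′ , refl , +-cancelˡ-≡ n _ _ (trans (sym (key-subset s′)) (trans eq (key-subset s)))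
    ... | isElement y = ⊥-elim (key-element≢key-subset y s eq)

  module Stage {j k : ℕ} (p≤j : p ≤ j) (stage : k ≡ suc t ⊎ j ≡ 2 ^ n)
               {m} {f : Fin (n + 2 ^ n) → Fin m} (r : Realises (key j k) f) where
    open Realises r

    partOfElement : ∀ {a} x → f a ≡ f (element x) →
                    Σ (Fin n) λ y → a ≡ element y × elementClass k (toℕ y) ≡ elementClass k (toℕ x)
    partOfElement x eq = key≡key-element _ x (sameKey eq)

    partOfSubset : ∀ {a} s → f a ≡ f (subset s) →
                   Σ (Fin (2 ^ n)) λ s′ → a ≡ subset s′ × subsetClass j (toℕ s′) ≡ subsetClass j (toℕ s)
    partOfSubset s eq = key≡key-subset _ s (sameKey eq)

    element-element : ∀ x y → Uniform f (f (element x)) (f (element y)) none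
    element-element x y a b fa fb with partOfElement x fa | partOfElement y fb
    ... | x′ , refl , _ | y′ , refl , _ = 𝓑-element-element x′ y′

    subset-subset : ∀ s s′ → Uniform f (f (subset s)) (f (subset s′)) none
    subset-subset s s′ a b fa fb with partOfSubset s fa | partOfSubset s′ fb
    ... | r , refl , _ | r′ , refl , _ = 𝓑-subset-subset r r′

    -- a subset not yet merged forms a part with a single element vertex (when k = t + 1)
    element-unmergedSubset : ∀ x s → ¬ toℕ s < j →
                             Uniform f (f (element x)) (f (subset s)) (memberColour (toℕ x) (toℕ s))
    element-unmergedSubset x s s≮j a b fa fb with partOfElement x fa | partOfSubset s fb
    ... | x′ , refl , x′~x | s′ , refl , s′~s = trans (𝓑-element-subset x′ s′) (cong₂ memberColour x′≡x s′≡s)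
      where
      k≡1+t : k ≡ suc t
      k≡1+t = [ (λ eq → eq) , (λ j≡2^n → ⊥-elim (s≮j (subst (toℕ s <_) (sym j≡2^n) (toℕ<n s)))) ]′ stage
      x′≡x : toℕ x′ ≡ toℕ x
      x′≡x = trans (sym (elementClass-1+t _))
        (trans (subst (λ k → elementClass k (toℕ x′) ≡ elementClass k (toℕ x)) k≡1+t x′~x) (elementClass-1+t _))
      s′≡s : toℕ s′ ≡ toℕ s
      s′≡s = [ (λ (_ , s<j , _) → ⊥-elim (s≮j s<j)) , (λ eq → eq) ]′ (subsetClass-≡ p≤j s′~s)

    -- a small element forms a part on its own, and merged subsets agree on it
    subset-smallElement : ∀ s y → toℕ y < t →
                          Uniform f (f (subset s)) (f (element y)) (memberColour (toℕ y) (toℕ s))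
    subset-smallElement s y y<t a b fa fb with partOfSubset s fa | partOfElement y fb
    ... | s′ , refl , s′~s | y′ , refl , y′~y =
      trans (𝓑-subset-element y′ s′) (trans (cong (λ e → memberColour e (toℕ s′)) y′≡y) (cong colourOf bits))
      where
      y′≡y : toℕ y′ ≡ toℕ y
      y′≡y = elementClass≡small k y<t (trans y′~y (elementClass-< k y<t))
      bits : testBit (toℕ s′) (toℕ y) ≡ testBit (toℕ s) (toℕ y)
      bits with subsetClass-≡ p≤j s′~s
      ... | inj₁ (_ , _ , low≡) = trans (sym (testBit-lowBits (toℕ s′) y<t))
                                     (trans (cong (λ z → testBit z (toℕ y)) low≡) (testBit-lowBits (toℕ s) y<t))
      ... | inj₂ s′≡s = cong (λ z → testBit z (toℕ y)) s′≡s

    subsetReps : List (Fin (n + 2 ^ n))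
    subsetReps = applyUpTo subsetAt p

    highElements : List (Fin (n + 2 ^ n))
    highElements = applyUpTo (λ i → elementAt (t + i)) (n ∸ t)

    element-fewRedParts : ∀ x → FewRedParts f d (element x)
    element-fewRedParts x = subsetReps , ≤-trans (≤-reflexive (length-applyUpTo subsetAt p)) p≤d , covered
      where
      covered : ∀ b → Covered f subsetReps (element x) b
      covered b with kind b
      ... | isElement y = inj₂ (none , (λ ()) , element-element x y)
      ... | isSubset s  = case toℕ s <? j of λ where
        (yes s<j) → inj₁ (subsetAt (lowBits t (toℕ s)) , ∈-applyUpTo⁺ subsetAt (lowBits< t (toℕ s)) ,
                     samePart (trans (key-subsetAt p≤j (lowBits< t (toℕ s)))
                                     (sym (trans (key-subset s) (cong (n +_) (subsetClass-< s<j))))))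
        (no s≮j)  → inj₂ (_ , memberColour-≢red (toℕ x) (toℕ s) , element-unmergedSubset x s s≮j)

    subset-fewRedParts : ∀ s → FewRedParts f d (subset s)
    subset-fewRedParts s = highElements , ≤-trans (≤-reflexive (length-applyUpTo _ (n ∸ t))) n∸t≤d , covered
      where
      covered : ∀ b → Covered f highElements (subset s) b
      covered b with kind b
      ... | isSubset s′ = inj₂ (none , (λ ()) , subset-subset s s′)
      ... | isElement y = case toℕ y <? t of λ where
        (yes y<t) → inj₂ (_ , memberColour-≢red (toℕ y) (toℕ s) , subset-smallElement s y y<t)
        (no y≮t)  → inj₁ (element y ,
          subst (_∈ highElements) (trans (cong elementAt (m+[n∸m]≡n (≮⇒≥ y≮t))) (elementAt-toℕ y))
                (∈-applyUpTo⁺ (λ i → elementAt (t + i)) (∸-monoˡ-< (toℕ<n y) (≮⇒≥ y≮t))) ,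
          refl)

    fewRedParts : ∀ {a} → Kind a → FewRedParts f d a
    fewRedParts (isElement x) = element-fewRedParts x
    fewRedParts (isSubset s)  = subset-fewRedParts s

  stage-bounded : ∀ {j k} → p ≤ j → k ≡ suc t ⊎ j ≡ 2 ^ n → QuotientBounded d (key j k)
  stage-bounded p≤j stage f onto r = FewRedParts⇒RedBounded onto (λ a → Stage.fewRedParts p≤j stage r (kind a))

  finalReps : List (Fin (n + 2 ^ n))
  finalReps = applyUpTo elementAt (suc t) ++ applyUpTo subsetAt p

  finalReps-represent : ∀ a → Σ (Fin (n + 2 ^ n)) λ l → l ∈ finalReps × key (2 ^ n) n l ≡ key (2 ^ n) n a
  finalReps-represent a with kind a
  ... | isSubset s = subsetAt (lowBits t (toℕ s)) ,
    ∈-++⁺ʳ (applyUpTo elementAt (suc t)) (∈-applyUpTo⁺ subsetAt (lowBits< t (toℕ s))) ,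
    trans (key-subsetAt p≤2^n (lowBits< t (toℕ s)))
          (sym (trans (key-subset s) (cong (n +_) (subsetClass-< (toℕ<n s)))))
  ... | isElement x with elementClass-cases n (toℕ x)
  ...   | inj₁ (_ , _ , x↦t) = elementAt t , ∈-++⁺ˡ (∈-applyUpTo⁺ elementAt (n<1+n t)) ,
    trans (key-elementAt t<n) (trans (elementClass-in ≤-refl t<n) (sym (trans (key-element x) x↦t)))
  ...   | inj₂ (∉ , _) = elementAt (toℕ x) , ∈-++⁺ˡ (∈-applyUpTo⁺ elementAt x<1+t) ,
                         cong (key (2 ^ n) n) (elementAt-toℕ x)
    where
    x<1+t : toℕ x < suc t
    x<1+t = s≤s (≮⇒≥ λ t<x → ∉ (<⇒≤ t<x , toℕ<n x))

  |finalReps|≤d : length finalReps ≤ d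
  |finalReps|≤d = ≤-trans (≤-reflexive (trans (length-++ (applyUpTo elementAt (suc t)))
    (cong₂ _+_ (length-applyUpTo elementAt (suc t)) (length-applyUpTo subsetAt p)))) 1+t+p≤d

  -- second phase: elements t + 1, …, n − 1 are merged into element t one at a time
  mergeElements : ∀ r k → t < k → k + r ≡ n → Contractible d (key (2 ^ n) k)
  mergeElements zero k _ k≡n = subst (λ k → Contractible d (key (2 ^ n) k)) (sym (trans (sym (+-identityʳ k)) k≡n))
    (Contractible-few d finalReps |finalReps|≤d finalReps-represent (elementAt 0))
  mergeElements (suc r) k t<k k+1+r≡n =
    Contractible-step d Kt≢Kk k-alone K′k≡Kt K′≡K (stage-bounded p≤2^n (inj₂ refl))
      (mergeElements r (suc k) (m≤n⇒m≤1+n t<k) (trans (sym (+-suc k r)) k+1+r≡n))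
    where
    K K′ : Fin (n + 2 ^ n) → ℕ
    K  = key (2 ^ n) k
    K′ = key (2 ^ n) (suc k)
    k<n : k < n
    k<n = subst (k <_) k+1+r≡n (m<m+n k (s≤s z≤n))
    Kt≡t : K (elementAt t) ≡ t
    Kt≡t = trans (key-elementAt t<n) (elementClass-in ≤-refl t<k)
    k↦k : elementClass k k ≡ k
    k↦k = elementClass-out λ (_ , k<k) → <-irrefl refl k<k
    Kk≡k : K (elementAt k) ≡ k
    Kk≡k = trans (key-elementAt k<n) k↦k
    Kt≢Kk : K (elementAt t) ≢ K (elementAt k)
    Kt≢Kk eq = <-irrefl (trans (sym Kt≡t) (trans eq Kk≡k)) t<k
    k-alone : ∀ c → K c ≡ K (elementAt k) → c ≡ elementAt k
    k-alone c eq with elementAt-< k<n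
    ... | z , at≡z , z≡k with key≡key-element c z (trans eq (cong K at≡z))
    ...   | y , refl , y~z = trans (cong element (toℕ-injective (trans y≡k (sym z≡k)))) (sym at≡z)
      where
      y≡k : toℕ y ≡ k
      y≡k = elementClass≡k t<k (trans y~z (trans (cong (elementClass k) z≡k) k↦k))
    K′k≡Kt : K′ (elementAt k) ≡ K (elementAt t)
    K′k≡Kt = trans (key-elementAt k<n) (trans (elementClass-in (<⇒≤ t<k) (n<1+n k)) (sym Kt≡t))
    K′≡K : ∀ c → c ≢ elementAt k → K′ c ≡ K c
    K′≡K c c≢k with kind c
    ... | isSubset s  = trans (key-subset s) (sym (key-subset s))
    ... | isElement y = trans (key-element y) (trans classes (sym (key-element y)))
      where
      y≢k : toℕ y ≢ k
      y≢k y≡k = c≢k (trans (sym (elementAt-toℕ y)) (cong elementAt y≡k))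
      classes : elementClass (suc k) (toℕ y) ≡ elementClass k (toℕ y)
      classes with elementClass-cases (suc k) (toℕ y) | elementClass-cases k (toℕ y)
      ... | inj₁ (_ , _ , eq₁)        | inj₁ (_ , _ , eq₂) = trans eq₁ (sym eq₂)
      ... | inj₂ (_ , eq₁)            | inj₂ (_ , eq₂)     = trans eq₁ (sym eq₂)
      ... | inj₁ (t≤y , y<1+k , _)    | inj₂ (∉ , _)       = ⊥-elim (∉ (t≤y , ≤∧≢⇒< (≤-pred y<1+k) y≢k))
      ... | inj₂ (∉ , _)              | inj₁ (t≤y , y<k , _) = ⊥-elim (∉ (t≤y , m≤n⇒m≤1+n y<k))

  -- first phase: subsets p, …, 2ⁿ − 1 are merged, one at a time, into the subset given by their t lowest bits
  mergeSubsets : ∀ r j → p ≤ j → j + r ≡ 2 ^ n → Contractible d (key j (suc t))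
  mergeSubsets zero j _ j≡2^n =
    subst (λ j → Contractible d (key j (suc t))) (sym (trans (sym (+-identityʳ j)) j≡2^n))
    (mergeElements (n ∸ suc t) (suc t) (n<1+n t) (m+[n∸m]≡n t<n))
  mergeSubsets (suc r) j p≤j j+1+r≡2^n =
    Contractible-step d Kc≢Kj j-alone K′j≡Kc K′≡K (stage-bounded p≤j (inj₁ refl))
      (mergeSubsets r (suc j) (m≤n⇒m≤1+n p≤j) (trans (sym (+-suc j r)) j+1+r≡2^n))
    where
    K K′ : Fin (n + 2 ^ n) → ℕ
    K  = key j (suc t)
    K′ = key (suc j) (suc t)
    j<2^n : j < 2 ^ n
    j<2^n = subst (j <_) j+1+r≡2^n (m<m+n j (s≤s z≤n))
    c : ℕ
    c = lowBits t j
    Kc≡n+c : K (subsetAt c) ≡ n + c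
    Kc≡n+c = key-subsetAt p≤j (lowBits< t j)
    j↦j : subsetClass j j ≡ j
    j↦j = subsetClass-≥ (<-irrefl refl)
    Kj≡n+j : K (subsetAt j) ≡ n + j
    Kj≡n+j with subsetAt-< j<2^n
    ... | x , at≡x , x≡j =
      trans (cong K at≡x) (trans (key-subset x) (cong (n +_) (trans (cong (subsetClass j) x≡j) j↦j)))
    Kc≢Kj : K (subsetAt c) ≢ K (subsetAt j)
    Kc≢Kj eq = <-irrefl (+-cancelˡ-≡ n _ _ (trans (sym Kc≡n+c) (trans eq Kj≡n+j))) (<-≤-trans (lowBits< t j) p≤j)
    j-alone : ∀ a → K a ≡ K (subsetAt j) → a ≡ subsetAt j
    j-alone a eq with subsetAt-< j<2^n
    ... | z , at≡z , z≡j with key≡key-subset a z (trans eq (cong K at≡z))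
    ...   | s , refl , s~z = trans (cong subset (toℕ-injective (trans s≡j (sym z≡j)))) (sym at≡z)
      where
      s≡j : toℕ s ≡ j
      s≡j = subsetClass≡j p≤j (trans s~z (trans (cong (subsetClass j) z≡j) j↦j))
    K′j≡Kc : K′ (subsetAt j) ≡ K (subsetAt c)
    K′j≡Kc with subsetAt-< j<2^n
    ... | x , at≡x , x≡j = trans (cong K′ at≡x) (trans (key-subset x)
      (trans (cong (n +_) (trans (cong (subsetClass (suc j)) x≡j) (subsetClass-< (n<1+n j)))) (sym Kc≡n+c)))
    K′≡K : ∀ a → a ≢ subsetAt j → K′ a ≡ K a
    K′≡K a a≢j with kind a
    ... | isElement y = trans (key-element y) (sym (key-element y))
    ... | isSubset s  = trans (key-subset s) (trans (cong (n +_) classes) (sym (key-subset s)))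
      where
      s≢j : toℕ s ≢ j
      s≢j s≡j = a≢j (trans (sym (subsetAt-toℕ s)) (cong subsetAt s≡j))
      classes : subsetClass (suc j) (toℕ s) ≡ subsetClass j (toℕ s)
      classes = case toℕ s <? j of λ where
        (yes s<j) → trans (subsetClass-< (m≤n⇒m≤1+n s<j)) (sym (subsetClass-< s<j))
        (no s≮j)  → trans (subsetClass-≥ (λ s<1+j → s≮j (≤∧≢⇒< (≤-pred s<1+j) s≢j))) (sym (subsetClass-≥ s≮j))

  key-injective : ∀ {a b} → key p (suc t) a ≡ key p (suc t) b → a ≡ b
  key-injective {a} {b} eq with kind a | kind b
  ... | isElement x | isElement y = cong element (toℕ-injective (trans (sym (elementClass-1+t _))
    (trans (sym (key-element x)) (trans eq (trans (key-element y) (elementClass-1+t _))))))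
  ... | isElement x | isSubset s  = ⊥-elim (key-element≢key-subset x s eq)
  ... | isSubset s  | isElement x = ⊥-elim (key-element≢key-subset x s (sym eq))
  ... | isSubset s  | isSubset s′ = cong subset (toℕ-injective (trans (sym (unmerged s))
    (trans (+-cancelˡ-≡ n _ _ (trans (sym (key-subset s)) (trans eq (key-subset s′)))) (unmerged s′))))
    where
    unmerged : ∀ s → subsetClass p (toℕ s) ≡ toℕ s
    unmerged s = case toℕ s <? p of λ where
      (yes s<p) → trans (subsetClass-< s<p) (lowBits-id {t} s<p)
      (no s≮p)  → subsetClass-≥ s≮p

  contractionSeq : ContractionSeq d (universalBipartite n)
  contractionSeq = mergeSubsets (2 ^ n ∸ p) p ≤-refl (m+[n∸m]≡n p≤2^n) 𝓑 (λ a → a) (λ a → a , refl)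
    (λ x y → sym (quotient-id 𝓑-loopless 𝓑-≢red x y))
    (record { sameKey = cong (key p (suc t)) ; samePart = key-injective })

n<2^n : ∀ n → n < 2 ^ n
n<2^n zero    = s≤s z≤n
n<2^n (suc n) = begin-strict
  suc n             ≤⟨ n<2^n n ⟩
  2 ^ n             <⟨ m<m+n (2 ^ n) (≤-trans (m^n>0 2 n) (m≤m+n (2 ^ n) 0)) ⟩
  2 ^ n + (2 ^ n + 0) ∎
  where open ≤-Reasoning

2^⌊log₂n⌋≤n : ∀ n → 0 < n → 2 ^ ⌊log₂ n ⌋ ≤ n
2^⌊log₂n⌋≤n = <-rec (λ n → 0 < n → 2 ^ ⌊log₂ n ⌋ ≤ n) halving
  where
  open ≤-Reasoning
  halving : ∀ n → (∀ {m} → m < n → 0 < m → 2 ^ ⌊log₂ m ⌋ ≤ m) → 0 < n → 2 ^ ⌊log₂ n ⌋ ≤ n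
  halving 1               _   _ = ≤-refl
  halving n@(suc (suc m)) rec _ = begin
    2 ^ ⌊log₂ n ⌋           ≡⟨ cong (2 ^_) log≡ ⟩
    2 * 2 ^ ⌊log₂ ⌊ n /2⌋ ⌋ ≤⟨ *-monoʳ-≤ 2 (rec (⌊n/2⌋<n (suc m)) (s≤s z≤n)) ⟩
    2 * ⌊ n /2⌋             ≡⟨ cong (⌊ n /2⌋ +_) (+-identityʳ _) ⟩
    ⌊ n /2⌋ + ⌊ n /2⌋       ≤⟨ +-monoʳ-≤ ⌊ n /2⌋ (⌊n/2⌋≤⌈n/2⌉ n) ⟩
    ⌊ n /2⌋ + ⌈ n /2⌉       ≡⟨ ⌊n/2⌋+⌈n/2⌉≡n n ⟩
    n                       ∎
    where
    log≡ : ⌊log₂ n ⌋ ≡ suc ⌊log₂ ⌊ n /2⌋ ⌋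
    log≡ = trans (sym (suc-pred ⌊log₂ n ⌋ {{>-nonZero (⌊log₂⌋-mono-≤ {2} {n} (s≤s (s≤s z≤n)))}}))
                 (cong suc (sym (⌊log₂⌊n/2⌋⌋≡⌊log₂n⌋∸1 n)))

⌊log₂[2^k*n]⌋ : ∀ k n .{{_ : NonZero n}} → ⌊log₂ (2 ^ k * n) ⌋ ≡ k + ⌊log₂ n ⌋
⌊log₂[2^k*n]⌋ zero    n = cong ⌊log₂_⌋ (+-identityʳ n)
⌊log₂[2^k*n]⌋ (suc k) n = begin
  ⌊log₂ (2 * 2 ^ k * n) ⌋   ≡⟨ cong ⌊log₂_⌋ (*-assoc 2 (2 ^ k) n) ⟩
  ⌊log₂ (2 * (2 ^ k * n)) ⌋ ≡⟨ ⌊log₂[2*b]⌋≡1+⌊log₂b⌋ (2 ^ k * n) {{m*n≢0 (2 ^ k) n {{m^n≢0 2 k}}}} ⟩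
  suc ⌊log₂ (2 ^ k * n) ⌋   ≡⟨ cong suc (⌊log₂[2^k*n]⌋ k n) ⟩
  suc k + ⌊log₂ n ⌋         ∎
  where open ≡-Reasoning

⌊log₂n⌋∸2+2≡⌊log₂n⌋ : ∀ {n} → 4 ≤ n → ⌊log₂ n ⌋ ∸ 2 + 2 ≡ ⌊log₂ n ⌋
⌊log₂n⌋∸2+2≡⌊log₂n⌋ {n} 4≤n = m∸n+n≡m (subst (_≤ ⌊log₂ n ⌋) (⌊log₂[2^n]⌋≡n 2) (⌊log₂⌋-mono-≤ {2 ^ 2} {n} 4≤n))

1+t+2^t+t≤n : ∀ {n} → 4 ≤ n → let t = ⌊log₂ n ⌋ ∸ 2 in suc t + 2 ^ t + t ≤ n
1+t+2^t+t≤n {n} 4≤n = begin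
  suc t + p + t   ≤⟨ +-mono-≤ (+-monoˡ-≤ p (n<2^n t)) (<⇒≤ (n<2^n t)) ⟩
  p + p + p       ≤⟨ m≤m+n (p + p + p) p ⟩
  p + p + p + p   ≡⟨ p+p+p+p≡p*4 p ⟩
  p * 4           ≡⟨ ^-distribˡ-+-* 2 t 2 ⟨
  2 ^ (t + 2)     ≡⟨ cong (2 ^_) (⌊log₂n⌋∸2+2≡⌊log₂n⌋ 4≤n) ⟩
  2 ^ ⌊log₂ n ⌋   ≤⟨ 2^⌊log₂n⌋≤n n (≤-trans (s≤s z≤n) 4≤n) ⟩
  n               ∎
  where
  open ≤-Reasoning
  t p : ℕ
  t = ⌊log₂ n ⌋ ∸ 2
  p = 2 ^ t
  p+p+p+p≡p*4 : ∀ p → p + p + p + p ≡ p * 4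
  p+p+p+p≡p*4 = solve-∀

twinWidth≤ : ∀ n → 4 ≤ n → ∃[ d ] ContractionSeq d (universalBipartite n) × d + ⌊log₂ n ⌋ ≤ n + 3
twinWidth≤ n 4≤n = n ∸ t , UpperBound.contractionSeq n t (n ∸ t) t<n p≤n∸t ≤-refl 1+t+p≤n∸t , d+L≤n+3
  where
  t p : ℕ
  t = ⌊log₂ n ⌋ ∸ 2
  p = 2 ^ t
  t<n : t < n
  t<n = ≤-trans (≤-trans (m≤m+n (suc t) p) (m≤m+n (suc t + p) t)) (1+t+2^t+t≤n 4≤n)
  1+t+p≤n∸t : suc t + p ≤ n ∸ t
  1+t+p≤n∸t = m+n≤o⇒m≤o∸n (suc t + p) (1+t+2^t+t≤n 4≤n)
  p≤n∸t : p ≤ n ∸ t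
  p≤n∸t = ≤-trans (m≤n+m p (suc t)) 1+t+p≤n∸t
  d+L≤n+3 : n ∸ t + ⌊log₂ n ⌋ ≤ n + 3
  d+L≤n+3 = begin
    n ∸ t + ⌊log₂ n ⌋ ≡⟨ cong (n ∸ t +_) (⌊log₂n⌋∸2+2≡⌊log₂n⌋ 4≤n) ⟨
    n ∸ t + (t + 2)   ≡⟨ +-assoc (n ∸ t) t 2 ⟨
    n ∸ t + t + 2     ≡⟨ cong (_+ 2) (m∸n+n≡m (<⇒≤ t<n)) ⟩
    n + 2             ≤⟨ +-monoʳ-≤ n (n≤1+n 2) ⟩
    n + 3             ∎
    where open ≤-Reasoning

twinWidth≥ : ∀ n → 2 ≤ n → ∀ d → ContractionSeq d (universalBipartite n) → n ≤ d + ⌊log₂ n ⌋ + 3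
twinWidth≥ (suc zero) (s≤s ()) _ _
twinWidth≥ n@(suc (suc _)) _ d seq with suc d ≤? n
... | no 1+d≰n = ≤-trans (≤-pred (≰⇒> 1+d≰n)) (≤-trans (m≤m+n d ⌊log₂ n ⌋) (m≤m+n (d + ⌊log₂ n ⌋) 3))
... | yes 1+d≤n = begin
  n                          ≡⟨ ⌊log₂[2^n]⌋≡n n ⟨
  ⌊log₂ (2 ^ n) ⌋            ≤⟨ ⌊log₂⌋-mono-≤ 2^n≤2^[d+3]*n ⟩
  ⌊log₂ (2 ^ (d + 3) * n) ⌋  ≡⟨ ⌊log₂[2^k*n]⌋ (d + 3) n ⟩
  d + 3 + ⌊log₂ n ⌋          ≡⟨ shuffle d ⌊log₂ n ⌋ ⟩
  d + ⌊log₂ n ⌋ + 3          ∎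
  where
  open ≤-Reasoning
  shuffle : ∀ d l → d + 3 + l ≡ d + l + 3
  shuffle = solve-∀
  regroup : ∀ n d → n * 2 ^ suc d * 4 ≡ 2 ^ (d + 3) * n
  regroup n d = trans (rearrange n (2 ^ d)) (cong (_* n) (sym (^-distribˡ-+-* 2 d 3)))
    where
    rearrange : ∀ n x → n * (2 * x) * 4 ≡ x * 8 * n
    rearrange = solve-∀
  2^n≤2^[d+3]*n : 2 ^ n ≤ 2 ^ (d + 3) * n
  2^n≤2^[d+3]*n = begin
    2 ^ n                      ≤⟨ LowerBound.2^n≤ n d {Fin.zero} {Fin.suc Fin.zero} (λ ()) seq ⟩
    suc d * 2 ^ suc d * 4      ≤⟨ *-monoˡ-≤ 4 (*-monoˡ-≤ (2 ^ suc d) 1+d≤n) ⟩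
    n * 2 ^ suc d * 4          ≡⟨ regroup n d ⟩
    2 ^ (d + 3) * n            ∎

mainTheorem6 : ∃[ C ] ∃[ N ] ∀ (n : ℕ) → N ≤ n →
    (∃[ d ] ContractionSeq d (universalBipartite n) × d + ⌊log₂ n ⌋ ≤ n + C)
    × (∀ (d : ℕ) → ContractionSeq d (universalBipartite n) → n ≤ d + ⌊log₂ n ⌋ + C)
mainTheorem6 = 3 , 4 , λ n 4≤n → twinWidth≤ n 4≤n , twinWidth≥ n (≤-trans (s≤s (s≤s z≤n)) 4≤n)
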